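{- Let $t$ be a PPC term. If $t\to_{PPC}t'$, then $\mathcal T(t)\to_{dB}\mathcal T(t')$.
   Context: **PPC.** Fix a countably infinite set of symbols. Terms: $t::=x\mid\hat x\mid t\,t\mid\lambda_\theta p.s$, where $\theta$ is a list of symbols binding the matchables $\hat x$ ($x\in\theta$) in $p$ and the variables $x$ in $s$. Free variables and matchables: $fv(x)=\{x\}$, $fm(\hat x)=\{x\}$ (empty otherwise); both are unions on applications; $fv(\lambda_\theta p.s)=fv(p)\cup(fv(s)\setminus\theta)$ and $fm(\lambda_\theta p.s)=(fm(p)\setminus\theta)\cup fm(s)$. Terms are taken modulo $\alpha$-conversion. Substitutions are finite partial maps from symbols to terms, acting capture-avoidingly on variable occurrences. A match is a substitution, $\mathtt{fail}$ or $\mathtt{wait}$ (decided if not $\mathtt{wait}$). Data structures are $d::=\hat x\mid d\,t$; matchable forms are $m::=d\mid\lambda_\theta t.t$. $\mu\uplus\mu'$ is $\mathtt{fail}$ if either match is $\mathtt{fail}$; else $\mathtt{wait}$ if either is $\mathtt{wait}$; else $\mathtt{fail}$ if the domains intersect; else the union. Matching $\{p/u\}_\theta$ (first applicable clause): 1. $\{\hat x/u\}_\theta=\{x\mapsto u\}$ if $x\in\theta$; 2. $\{\hat x/\hat x\}_\theta=\{\}$ if $x\notin\theta$; 3. $\{p\,q/t\,u\}_\theta=\{p/t\}_\theta\uplus\{q/u\}_\theta$ if both are matchable forms; 4. $\mathtt{fail}$ if $p,u$ are matchable forms; 5. $\mathtt{wait}$ otherwise. A substitution result whose domain is not exactly $\theta$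 becomes $\mathtt{fail}$. A substitution $\sigma$ applied to $s$ gives $\sigma s$, and $\mathtt{fail}$ applied to any term gives $\lambda_{[x]}\hat x.x$. $\to_{PPC}$ is the contextual closure of $(\lambda_\theta p.s)u\to\{p/u\}_\theta s$ when the match is decided. **PPC_dB.** Terms: $t::=\mathsf v_{i,j}\mid\mathsf m_{i,j}\mid t\,t\mid\lambda_np.s$, with $i,j\ge1$ and $n\in\mathbb N$. Variable increment at depth $k$: $\uparrow^{\mathsf v}_k\mathsf v_{i,j}=\mathsf v_{i+1,j}$ if $i>k$, else unchanged; matchables unchanged; homomorphic on applications; $\uparrow^{\mathsf v}_k(\lambda_np.s)=\lambda_n\uparrow^{\mathsf v}_kp.\uparrow^{\mathsf v}_{k+1}s$. Matchable increment $\uparrow^{\mathsf m}_k$ is symmetric, with $\uparrow^{\mathsf m}_k(\lambda_np.s)=\lambda_n\uparrow^{\mathsf m}_{k+1}p.\uparrow^{\mathsf m}_ks$. $\downarrow^{\mathsf v}_k$ is like $\uparrow^{\mathsf v}_k$ but subtracts $1$. The default depth is $k=0$. Substitution at level $i$, $\{\mathsf v_{i,j}\mapsto u_j\}_{j\in J}$: - maps $\mathsf v_{i,k}$ to $u_k$ ($k\in J$), leaves $\mathsf v_{i',k}$ with $i'\neq i$ and matchables unchanged; - is homomorphic on applications; - maps $\lambda_np.s$ to $\lambda_n(\{\mathsf v_{i,j}\mapsto\uparrow^{\mathsf m}u_j\}p).(\{\mathsf v_{i+1,j}\mapsto\uparrow^{\mathsf v}u_j\}s)$. Data structures are $d::=\mathsf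 m_{i,j}\mid d\,t$; matchable forms are $m::=d\mid\lambda_nt.t$. Matching $\{p/u\}_n$: $\{\mathsf m_{1,j}/u\}_n=\{\mathsf v_{1,j}\mapsto u\}$; $\{\mathsf m_{i+1,j}/\mathsf m_{i,j}\}_n=\{\}$; then the application, $\mathtt{fail}$ and $\mathtt{wait}$ clauses as in PPC. A result whose domain is not $\{\mathsf v_{1,1},\dots,\mathsf v_{1,n}\}$ becomes $\mathtt{fail}$. $\mathtt{fail}$ applied to any term gives $\lambda_1\mathsf m_{1,1}.\mathsf v_{1,1}$. $\to_{dB}$ is the contextual closure of $(\lambda_np.s)u\to\downarrow^{\mathsf v}(\{p/\uparrow^{\mathsf v}u\}_ns)$ when the match is decided. Equality is modulo permutation of the secondary indices bound by the same abstraction. **Translation.** For lists of lists of symbols $V,M$ ($V_{ij}$ is the $j$-th element of the $i$-th list; $\theta++V$ means $[\theta]++V$): - $\mathcal T_{V,M}(x)=\mathsf v_{i,j}$ with $i=\min\{i'\mid x\in V_{i'}\}$ and $j=\min\{j'\mid x=V_{ij'}\}$; - $\mathcal T_{V,M}(\hat x)=\mathsf m_{i,j}$, likewise using $M$; - homomorphic on applications; - $\mathcal T_{V,M}(\lambda_\theta p.s)=\lambda_{|\theta|}\mathcal T_{V,\theta++M}(p).\mathcal T_{\theta++V,M}(s)$. Fixing an enumeration $x_1,x_2,\ldots$ of the symbols, $\mathcal T(t)=\mathcal T_{X,X}(t)$ with $X=[[x_1],\dots,[x_n]]$ and $fv(t)\cup fm(t)\subseteq\{x_1,\dots,x_n\}$.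 -}

module Defs where

open import Data.Nat using (ℕ; zero; suc; _<_; _≡ᵇ_; _<ᵇ_; _∸_)
open import Data.Bool using (Bool; true; false; _∧_; _∨_; not; if_then_else_; T)
open import Data.List using (List; []; _∷_; _++_; map; length; concatMap; upTo)
open import Data.List.Relation.Unary.All using (All)
open import Data.List.Relation.Unary.Unique.Propositional using (Unique)
open import Data.Maybe using (Maybe; just; nothing; fromMaybe)
import Data.Maybe as Maybe
open import Data.Product using (_×_; _,_; proj₁; proj₂; ∃₂)
open import Data.Unit using (⊤)
open import Data.Fin using (Fin; toℕ)
import Data.Fin as Fin
open import Data.Fin.Permutation using (Permutation′; _⟨$⟩ʳ_)
open import Relation.Binary.PropositionalEquality using (_≡_)

-- Generic helpers.  Symbols are natural numbers; the fixed enumeration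
-- x_1, x_2, ... of the symbols is x_k = k ∸ 1 (i.e. x_{k} is the number k-1).

infix 4 _∈ᵇ_
_∈ᵇ_ : ℕ → List ℕ → Bool
x ∈ᵇ []       = false
x ∈ᵇ (y ∷ ys) = (x ≡ᵇ y) ∨ (x ∈ᵇ ys)

minus : List ℕ → List ℕ → List ℕ
minus []      θ = []
minus (x ∷ l) θ = if x ∈ᵇ θ then minus l θ else x ∷ minus l θ

allᵇ : (ℕ → Bool) → List ℕ → Bool
allᵇ f []       = true
allᵇ f (x ∷ xs) = f x ∧ allᵇ f xs

anyᵇ : (ℕ → Bool) → List ℕ → Bool
anyᵇ f []       = false
anyᵇ f (x ∷ xs) = f x ∨ anyᵇ f xs

sameSet : List ℕ → List ℕ → Bool
sameSet a b = allᵇ (λ x → x ∈ᵇ b) a ∧ allᵇ (λ x → x ∈ᵇ a) b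

disjointᵇ : List ℕ → List ℕ → Bool
disjointᵇ a b = not (anyᵇ (λ x → x ∈ᵇ b) a)

lookup : {A : Set} → List (ℕ × A) → ℕ → Maybe A
lookup []             k = nothing
lookup ((x , a) ∷ σ) k = if k ≡ᵇ x then just a else lookup σ k

dom : {A : Set} → List (ℕ × A) → List ℕ
dom = map proj₁

data Match (A : Set) : Set where
  fail : Match A
  wait : Match A
  ok   : List (ℕ × A) → Match A

_⊎ₘ_ : {A : Set} → Match A → Match A → Match A
fail ⊎ₘ _    = fail
wait ⊎ₘ fail = fail
wait ⊎ₘ _    = wait
ok σ ⊎ₘ fail = fail
ok σ ⊎ₘ wait = wait
ok σ ⊎ₘ ok τ = if disjointᵇ (dom σ) (dom τ) then ok (σ ++ τ) else fail

-- PPC (raw named syntax; the calculus works modulo ≈α below)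

data Term : Set where
  var : ℕ → Term
  mat : ℕ → Term
  app : Term → Term → Term
  lam : List ℕ → Term → Term → Term    -- λ_θ p . s

fv : Term → List ℕ
fv (var x)     = x ∷ []
fv (mat x)     = []
fv (app t u)   = fv t ++ fv u
fv (lam θ p s) = fv p ++ minus (fv s) θ

fm : Term → List ℕ
fm (var x)     = []
fm (mat x)     = x ∷ []
fm (app t u)   = fm t ++ fm u
fm (lam θ p s) = minus (fm p) θ ++ fm s

syms : Term → List ℕ
syms (var x)     = x ∷ []
syms (mat x)     = x ∷ []
syms (app t u)   = syms t ++ syms u
syms (lam θ p s) = θ ++ syms p ++ syms s

WF : Term → Set
WF (var x)     = ⊤
WF (mat x)     = ⊤
WF (app t u)   = WF t × WF u
WF (lam θ p s) = Unique θ × WF p × WF s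

renM : ℕ → ℕ → Term → Term
renM x y (var z)     = var z
renM x y (mat z)     = mat (if z ≡ᵇ x then y else z)
renM x y (app t u)   = app (renM x y t) (renM x y u)
renM x y (lam θ p s) = if x ∈ᵇ θ then lam θ p (renM x y s)
                                 else lam θ (renM x y p) (renM x y s)

renV : ℕ → ℕ → Term → Term
renV x y (var z)     = var (if z ≡ᵇ x then y else z)
renV x y (mat z)     = mat z
renV x y (app t u)   = app (renV x y t) (renV x y u)
renV x y (lam θ p s) = lam θ (renV x y p) (if x ∈ᵇ θ then s else renV x y s)

swapTo : ℕ → ℕ → ℕ → ℕ
swapTo x y z = if z ≡ᵇ x then y else z

infix 4 _≈α_
data _≈α_ : Term → Term → Set where
  α-rename : ∀ {θ p s x y} → T (x ∈ᵇ θ) → T (not (y ∈ᵇ syms (lam θ p s))) →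
             lam θ p s ≈α lam (map (swapTo x y) θ) (renM x y p) (renV x y s)
  α-refl   : ∀ {t} → t ≈α t
  α-sym    : ∀ {t u} → t ≈α u → u ≈α t
  α-trans  : ∀ {t u v} → t ≈α u → u ≈α v → t ≈α v
  α-appL   : ∀ {t t' u} → t ≈α t' → app t u ≈α app t' u
  α-appR   : ∀ {t u u'} → u ≈α u' → app t u ≈α app t u'
  α-lamP   : ∀ {θ p p' s} → p ≈α p' → lam θ p s ≈α lam θ p' s
  α-lamS   : ∀ {θ p s s'} → s ≈α s' → lam θ p s ≈α lam θ p s'

isData : Term → Bool
isData (mat x)   = true
isData (app t u) = isData t
isData _         = false

isMF : Term → Bool
isMF (lam θ p s) = true
isMF t           = isData t

fallback : Term → Term → Match Term
fallback p u = if isMF p ∧ isMF u then fail else wait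

pmatch : List ℕ → Term → Term → Match Term
pmatch θ (mat x) u with x ∈ᵇ θ
... | true  = ok ((x , u) ∷ [])
pmatch θ (mat x) (mat y) | false =
  if x ≡ᵇ y then ok [] else fallback (mat x) (mat y)
pmatch θ (mat x) u | false = fallback (mat x) u
pmatch θ (app p q) (app t u) =
  if isMF (app p q) ∧ isMF (app t u)
  then pmatch θ p t ⊎ₘ pmatch θ q u
  else fallback (app p q) (app t u)
pmatch θ p u = fallback p u

matchPPC : List ℕ → Term → Term → Match Term
matchPPC θ p u with pmatch θ p u
... | ok σ = if sameSet (dom σ) θ then ok σ else fail
... | fail = fail
... | wait = wait

dropDom : List (ℕ × Term) → List ℕ → List (ℕ × Term)
dropDom []             θ = []
dropDom ((x , u) ∷ σ) θ = if x ∈ᵇ θ then dropDom σ θ else (x , u) ∷ dropDom σ θ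

-- substitution on variable occurrences (capture-avoiding whenever
-- Avoids below holds; in general one first α-converts)
subst : List (ℕ × Term) → Term → Term
subst σ (var x)     = fromMaybe (var x) (lookup σ x)
subst σ (mat x)     = mat x
subst σ (app t u)   = app (subst σ t) (subst σ u)
subst σ (lam θ p s) = lam θ (subst σ p) (subst (dropDom σ θ) s)

rangeSyms : List (ℕ × Term) → List ℕ
rangeSyms σ = concatMap (λ xu → fv (proj₂ xu) ++ fm (proj₂ xu)) σ

Avoids : List ℕ → Term → Set
Avoids L (var x)     = ⊤
Avoids L (mat x)     = ⊤
Avoids L (app t u)   = Avoids L t × Avoids L u
Avoids L (lam θ p s) = T (disjointᵇ θ L) × Avoids L p × Avoids L s

failPPC : Term
failPPC = lam (0 ∷ []) (mat 0) (var 0)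

infix 4 _⟶_
data _⟶_ : Term → Term → Set where
  β-ok   : ∀ {θ p s u σ} → matchPPC θ p u ≡ ok σ → Avoids (rangeSyms σ) s →
           app (lam θ p s) u ⟶ subst σ s
  β-fail : ∀ {θ p s u} → matchPPC θ p u ≡ fail →
           app (lam θ p s) u ⟶ failPPC
  ⟶appL  : ∀ {t t' u} → t ⟶ t' → app t u ⟶ app t' u
  ⟶appR  : ∀ {t u u'} → u ⟶ u' → app t u ⟶ app t u'
  ⟶lamP  : ∀ {θ p p' s} → p ⟶ p' → lam θ p s ⟶ lam θ p' s
  ⟶lamS  : ∀ {θ p s s'} → s ⟶ s' → lam θ p s ⟶ lam θ p s'

-- →_PPC on α-equivalence classes
infix 4 _→PPC_
_→PPC_ : Term → Term → Set
t →PPC t' = ∃₂ λ t₁ t₂ → t ≈α t₁ × t₁ ⟶ t₂ × t₂ ≈α t'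

data DTm : Set where
  var : ℕ → ℕ → DTm
  mat : ℕ → ℕ → DTm
  app : DTm → DTm → DTm
  lam : ℕ → DTm → DTm → DTm

upV : ℕ → DTm → DTm
upV k (var i j)   = if k <ᵇ i then var (suc i) j else var i j
upV k (mat i j)   = mat i j
upV k (app t u)   = app (upV k t) (upV k u)
upV k (lam n p s) = lam n (upV k p) (upV (suc k) s)

upM : ℕ → DTm → DTm
upM k (var i j)   = var i j
upM k (mat i j)   = if k <ᵇ i then mat (suc i) j else mat i j
upM k (app t u)   = app (upM k t) (upM k u)
upM k (lam n p s) = lam n (upM (suc k) p) (upM k s)

downV : ℕ → DTm → DTm
downV k (var i j)   = if k <ᵇ i then var (i ∸ 1) j else var i j
downV k (mat i j)   = mat i j
downV k (app t u)   = app (downV k t) (downV k u)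
downV k (lam n p s) = lam n (downV k p) (downV (suc k) s)

mapRange : (DTm → DTm) → List (ℕ × DTm) → List (ℕ × DTm)
mapRange f = map (λ ju → proj₁ ju , f (proj₂ ju))

-- {v_{i,j} ↦ u_j}_{j ∈ J}, the list giving the pairs (j , u_j)
dsubst : ℕ → List (ℕ × DTm) → DTm → DTm
dsubst i σ (var i' k)  = if i' ≡ᵇ i then fromMaybe (var i' k) (lookup σ k) else var i' k
dsubst i σ (mat i' k)  = mat i' k
dsubst i σ (app t u)   = app (dsubst i σ t) (dsubst i σ u)
dsubst i σ (lam n p s) = lam n (dsubst i (mapRange (upM 0) σ) p)
                               (dsubst (suc i) (mapRange (upV 0) σ) s)

isDataD : DTm → Bool
isDataD (mat i j)  = true
isDataD (app t u)  = isDataD t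
isDataD _          = false

isMFD : DTm → Bool
isMFD (lam n p s) = true
isMFD t           = isDataD t

fallbackD : DTm → DTm → Match DTm
fallbackD p u = if isMFD p ∧ isMFD u then fail else wait

dmatch : DTm → DTm → Match DTm
dmatch (mat (suc zero) j) u = ok ((j , u) ∷ [])
dmatch (mat (suc (suc i)) j) (mat i' j') =
  if (suc i ≡ᵇ i') ∧ (j ≡ᵇ j') then ok [] else fallbackD (mat (suc (suc i)) j) (mat i' j')
dmatch (app p q) (app t u) =
  if isMFD (app p q) ∧ isMFD (app t u)
  then dmatch p t ⊎ₘ dmatch q u
  else fallbackD (app p q) (app t u)
dmatch p u = fallbackD p u

matchDB : ℕ → DTm → DTm → Match DTm
matchDB n p u with dmatch p u
... | ok σ = if sameSet (dom σ) (map suc (upTo n)) then ok σ else fail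
... | fail = fail
... | wait = wait

failDB : DTm
failDB = lam 1 (mat 1 1) (var 1 1)

infix 4 _⟶ᵈ_
data _⟶ᵈ_ : DTm → DTm → Set where
  β-ok   : ∀ {n p s u σ} → matchDB n p (upV 0 u) ≡ ok σ →
           app (lam n p s) u ⟶ᵈ downV 0 (dsubst 1 σ s)
  β-fail : ∀ {n p s u} → matchDB n p (upV 0 u) ≡ fail →
           app (lam n p s) u ⟶ᵈ downV 0 failDB
  ⟶appL  : ∀ {t t' u} → t ⟶ᵈ t' → app t u ⟶ᵈ app t' u
  ⟶appR  : ∀ {t u u'} → u ⟶ᵈ u' → app t u ⟶ᵈ app t u'
  ⟶lamP  : ∀ {n p p' s} → p ⟶ᵈ p' → lam n p s ⟶ᵈ lam n p' s
  ⟶lamS  : ∀ {n p s s'} → s ⟶ᵈ s' → lam n p s ⟶ᵈ lam n p s'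

toFinM : (n j : ℕ) → Maybe (Fin n)
toFinM zero    j       = nothing
toFinM (suc n) zero    = just Fin.zero
toFinM (suc n) (suc j) = Maybe.map Fin.suc (toFinM n j)

permIdx : {n : ℕ} → Permutation′ n → ℕ → ℕ
permIdx {n} π zero    = zero
permIdx {n} π (suc j) with toFinM n j
... | just f  = suc (toℕ (π ⟨$⟩ʳ f))
... | nothing = suc j

permV : {n : ℕ} → Permutation′ n → ℕ → DTm → DTm
permV π k (var i j)   = if i ≡ᵇ suc k then var i (permIdx π j) else var i j
permV π k (mat i j)   = mat i j
permV π k (app t u)   = app (permV π k t) (permV π k u)
permV π k (lam m p s) = lam m (permV π k p) (permV π (suc k) s)

permM : {n : ℕ} → Permutation′ n → ℕ → DTm → DTm
permM π k (var i j)   = var i j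
permM π k (mat i j)   = if i ≡ᵇ suc k then mat i (permIdx π j) else mat i j
permM π k (app t u)   = app (permM π k t) (permM π k u)
permM π k (lam m p s) = lam m (permM π (suc k) p) (permM π k s)

infix 4 _≈ᵖ_
data _≈ᵖ_ : DTm → DTm → Set where
  ≈-perm  : ∀ {n p s} (π : Permutation′ n) → lam n p s ≈ᵖ lam n (permM π 0 p) (permV π 0 s)
  ≈-refl  : ∀ {t} → t ≈ᵖ t
  ≈-sym   : ∀ {t u} → t ≈ᵖ u → u ≈ᵖ t
  ≈-trans : ∀ {t u v} → t ≈ᵖ u → u ≈ᵖ v → t ≈ᵖ v
  ≈-appL  : ∀ {t t' u} → t ≈ᵖ t' → app t u ≈ᵖ app t' u
  ≈-appR  : ∀ {t u u'} → u ≈ᵖ u' → app t u ≈ᵖ app t u'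
  ≈-lamP  : ∀ {n p p' s} → p ≈ᵖ p' → lam n p s ≈ᵖ lam n p' s
  ≈-lamS  : ∀ {n p s s'} → s ≈ᵖ s' → lam n p s ≈ᵖ lam n p s'

infix 4 _→dB_
_→dB_ : DTm → DTm → Set
a →dB b = ∃₂ λ a₁ b₁ → a ≈ᵖ a₁ × a₁ ⟶ᵈ b₁ × b₁ ≈ᵖ b

-- 1-based position of the first occurrence
pos : ℕ → List ℕ → Maybe ℕ
pos x []       = nothing
pos x (y ∷ ys) = if x ≡ᵇ y then just 1 else Maybe.map suc (pos x ys)

find : ℕ → List (List ℕ) → Maybe (ℕ × ℕ)
find x []       = nothing
find x (l ∷ ls) with pos x l
... | just j  = just (1 , j)
... | nothing = Maybe.map (λ ij → suc (proj₁ ij) , proj₂ ij) (find x ls)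

map2 : {A B C : Set} → (A → B → C) → Maybe A → Maybe B → Maybe C
map2 f (just a) (just b) = just (f a b)
map2 f _        _        = nothing

-- undefined (nothing) exactly when some free symbol is not found
tr : List (List ℕ) → List (List ℕ) → Term → Maybe DTm
tr V M (var x)     = Maybe.map (λ ij → var (proj₁ ij) (proj₂ ij)) (find x V)
tr V M (mat x)     = Maybe.map (λ ij → mat (proj₁ ij) (proj₂ ij)) (find x M)
tr V M (app t u)   = map2 app (tr V M t) (tr V M u)
tr V M (lam θ p s) = map2 (lam (length θ)) (tr V (θ ∷ M) p) (tr (θ ∷ V) M s)

X : ℕ → List (List ℕ)
X n = map (λ k → k ∷ []) (upTo n)

𝒯 : ℕ → Term → Maybe DTm
𝒯 n t = tr (X n) (X n) t

Covered : ℕ → Term → Set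
Covered n t = All (_< n) (fv t ++ fm t)

module Submission where

-- 𝒯 n = tr (X n) (X n) is an instance of the compositional translation
-- tr V M under scope stacks V (variables) and M (matchables), and the proof
-- is a simulation argument for tr V M with arbitrary stacks:
--   * 𝒯 n t is defined for covered t, and tr is invariant under
--     α-conversion, so it suffices to simulate one raw step t₁ ⟶ t₂;
--   * congruence steps are simulated by the same congruence steps;
--   * a redex (λ_θ p.s) u needs two commutation results:
--     Matching: {p/u}_θ and {tr p/↑ᵛ tr u}_|θ| have the same outcome, and
--       successful results correspond binding-wise (x ↦ u versus
--       pos x θ ↦ ↑ᵛ tr u);
--     Substitution: tr (σ s) = ↓ᵛ (σ' (tr s)) for corresponding σ, σ',
--       generalised to occurrences under the binders crossed inside s.
-- Both rest on the shifting lemmas tr-upV and tr-upM: ↑ᵛ/↑ᵐ at depth k of a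
-- translation is the translation under the stack with an empty scope
-- inserted at depth k.

open import Defs
open import Data.Nat using (ℕ; zero; suc; _+_; _∸_; _≤_; _<_; _≡ᵇ_; _<ᵇ_; z≤n; s≤s)
open import Data.Nat.Properties
  using (≡ᵇ⇒≡; ≡⇒≡ᵇ; <ᵇ⇒<; <⇒<ᵇ; ≤⇒≯; 1+n≰n; m<m+n; m<n⇒m<1+n; m+1+n≢m; +-comm; +-suc; suc-injective)
open import Data.Bool using (true; false; _∧_; _∨_; not; if_then_else_; T)
open import Data.Bool.Properties using (T-≡; T-not-≡; T-∧)
open import Data.List using (List; []; _∷_; _++_; map; length; upTo)
open import Data.List.Properties using (length-map)
open import Data.List.Relation.Unary.All using (All; []; _∷_)
import Data.List.Relation.Unary.All as All
import Data.List.Relation.Unary.All.Properties as AllProperties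
open import Data.List.Relation.Unary.Any using (here; there)
open import Data.List.Relation.Unary.AllPairs using ([]; _∷_)
open import Data.List.Relation.Unary.Unique.Propositional using (Unique)
import Data.List.Relation.Unary.Unique.Propositional.Properties as Unique
open import Data.List.Relation.Binary.Pointwise using (Pointwise; []; _∷_; ++⁺)
open import Data.List.Relation.Binary.Subset.Propositional using (_⊆_)
open import Data.List.Membership.Propositional using (_∈_; _∉_)
open import Data.List.Membership.Propositional.Properties
  using (∈-++⁺ˡ; ∈-++⁺ʳ; ∈-++⁻; ∈-upTo⁺; ∈-upTo⁻; ∈-map⁺; ∈-map⁻)
open import Data.Maybe using (Maybe; just; nothing; is-just)
import Data.Maybe as Maybe
open import Data.Product using (_×_; _,_; proj₁; proj₂; ∃; ∃₂)
import Data.Product as Product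
open import Data.Sum using (_⊎_; inj₁; inj₂)
open import Data.Unit using (tt)
open import Data.Empty using (⊥-elim)
open import Function using (_∘_; id)
open import Function.Bundles using (Equivalence)
open import Relation.Nullary using (¬_)
open import Relation.Binary.PropositionalEquality using (_≡_; _≢_; refl; sym; trans; cong; cong₂)
import Relation.Binary.PropositionalEquality as ≡

T⇒≡true : ∀ {b} → T b → b ≡ true
T⇒≡true = Equivalence.to T-≡

≡true⇒T : ∀ {b} → b ≡ true → T b
≡true⇒T = Equivalence.from T-≡

¬T⇒≡false : ∀ {b} → ¬ T b → b ≡ false
¬T⇒≡false {true}  ¬t = ⊥-elim (¬t tt)
¬T⇒≡false {false} _  = refl

≡false⇒¬T : ∀ {b} → b ≡ false → ¬ T b
≡false⇒¬T refl ()

-- The equality test _≡ᵇ_ on ℕ, viewed together with the value it computes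
-- (so that both the proposition and the boolean can be used for rewriting).
data ≡ᵇ-View (m n : ℕ) : Set where
  equal    : m ≡ n → (m ≡ᵇ n) ≡ true  → ≡ᵇ-View m n
  distinct : m ≢ n → (m ≡ᵇ n) ≡ false → ≡ᵇ-View m n

≡ᵇ-view : ∀ m n → ≡ᵇ-View m n
≡ᵇ-view m n with m ≡ᵇ n in e
... | true  = equal (≡ᵇ⇒≡ m n (≡true⇒T e)) e
... | false = distinct (λ m≡n → ≡false⇒¬T e (≡⇒≡ᵇ m n m≡n)) e

≡ᵇ-refl : ∀ n → (n ≡ᵇ n) ≡ true
≡ᵇ-refl n = T⇒≡true (≡⇒≡ᵇ n n refl)

≢⇒≡ᵇ-false : ∀ {m n} → m ≢ n → (m ≡ᵇ n) ≡ false
≢⇒≡ᵇ-false {m} {n} m≢n with ≡ᵇ-view m n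
... | equal m≡n _ = ⊥-elim (m≢n m≡n)
... | distinct _ e = e

T-ext : ∀ {a b} → (T a → T b) → (T b → T a) → a ≡ b
T-ext {true}  {true}  _ _ = refl
T-ext {true}  {false} f _ = ⊥-elim (f tt)
T-ext {false} {true}  _ g = ⊥-elim (g tt)
T-ext {false} {false} _ _ = refl

∈ᵇ⇒∈ : ∀ {x} l → T (x ∈ᵇ l) → x ∈ l
∈ᵇ⇒∈ {x} (w ∷ l) t with x ≡ᵇ w in e
... | true  = here (≡ᵇ⇒≡ x w (≡true⇒T e))
... | false = there (∈ᵇ⇒∈ l t)

∈⇒∈ᵇ : ∀ {x l} → x ∈ l → T (x ∈ᵇ l)
∈⇒∈ᵇ {x} (here refl) rewrite ≡ᵇ-refl x = tt
∈⇒∈ᵇ {x} {w ∷ l} (there m) with x ≡ᵇ w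
... | true  = tt
... | false = ∈⇒∈ᵇ m

∉⇒∈ᵇ-false : ∀ {x l} → x ∉ l → (x ∈ᵇ l) ≡ false
∉⇒∈ᵇ-false x∉l = ¬T⇒≡false (x∉l ∘ ∈ᵇ⇒∈ _)

∈ᵇ-false⇒∉ : ∀ {x l} → (x ∈ᵇ l) ≡ false → x ∉ l
∈ᵇ-false⇒∉ e = ≡false⇒¬T e ∘ ∈⇒∈ᵇ

∉ᵇ⇒∉ : ∀ {x l} → T (not (x ∈ᵇ l)) → x ∉ l
∉ᵇ⇒∉ t = ∈ᵇ-false⇒∉ (Equivalence.to T-not-≡ t)

∈-minus⁻ : ∀ {x} l θ → x ∈ minus l θ → x ∈ l × x ∉ θ
∈-minus⁻ (w ∷ l) θ m with w ∈ᵇ θ in e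
... | true = Product.map₁ there (∈-minus⁻ l θ m)
... | false with m
...   | here refl = here refl , ∈ᵇ-false⇒∉ e
...   | there m'  = Product.map₁ there (∈-minus⁻ l θ m')

∈-minus⁺ : ∀ {x} l θ → x ∈ l → x ∉ θ → x ∈ minus l θ
∈-minus⁺ (w ∷ l) θ (here refl) x∉θ rewrite ∉⇒∈ᵇ-false x∉θ = here refl
∈-minus⁺ (w ∷ l) θ (there m) x∉θ with w ∈ᵇ θ
... | true  = ∈-minus⁺ l θ m x∉θ
... | false = there (∈-minus⁺ l θ m x∉θ)

is-just-map : ∀ {A B : Set} (f : A → B) (m : Maybe A) → is-just (Maybe.map f m) ≡ is-just m
is-just-map f (just _) = refl
is-just-map f nothing  = refl

∈ᵇ-pos : ∀ x l → (x ∈ᵇ l) ≡ is-just (pos x l)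
∈ᵇ-pos x []      = refl
∈ᵇ-pos x (w ∷ l) with x ≡ᵇ w
... | true  = refl
... | false = trans (∈ᵇ-pos x l) (sym (is-just-map suc (pos x l)))

pos-nothing⇒∉ : ∀ {x l} → pos x l ≡ nothing → x ∉ l
pos-nothing⇒∉ {x} {l} e = ≡false⇒¬T (trans (∈ᵇ-pos x l) (cong is-just e)) ∘ ∈⇒∈ᵇ

pos-just⇒∈ : ∀ {x l j} → pos x l ≡ just j → x ∈ l
pos-just⇒∈ {x} {l} e = ∈ᵇ⇒∈ l (≡true⇒T (trans (∈ᵇ-pos x l) (cong is-just e)))

∈⇒pos : ∀ {x l} → x ∈ l → ∃ λ j → pos x l ≡ just j
∈⇒pos {x} {l} m with pos x l in e
... | just j  = j , refl
... | nothing = ⊥-elim (pos-nothing⇒∉ e m)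

∉⇒pos : ∀ {x} l → x ∉ l → pos x l ≡ nothing
∉⇒pos {x} l x∉l with pos x l in e
... | just _  = ⊥-elim (x∉l (pos-just⇒∈ e))
... | nothing = refl

pos-here : ∀ {x w} l → (x ≡ᵇ w) ≡ true → pos x (w ∷ l) ≡ just 1
pos-here l e rewrite e = refl

pos-there : ∀ {x w} l → (x ≡ᵇ w) ≡ false → pos x (w ∷ l) ≡ Maybe.map suc (pos x l)
pos-there l e rewrite e = refl

map-suc-just : ∀ (m : Maybe ℕ) {j} → Maybe.map suc m ≡ just j → ∃ λ k → m ≡ just k × j ≡ suc k
map-suc-just (just k) refl = k , refl , refl

pos-bounded : ∀ {x} l {j} → pos x l ≡ just j → ∃ λ j₀ → j ≡ suc j₀ × j₀ < length l
pos-bounded {x} (w ∷ l) e with ≡ᵇ-view x w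
... | equal _ ew with trans (sym (pos-here l ew)) e
...   | refl = 0 , refl , s≤s z≤n
pos-bounded {x} (w ∷ l) e | distinct _ ew with map-suc-just (pos x l) (trans (sym (pos-there l ew)) e)
... | k , pk , refl with pos-bounded l pk
...   | k₀ , refl , k₀<l = suc k₀ , refl , s≤s k₀<l

pos-tail≢1 : ∀ {x w} l → (x ≡ᵇ w) ≡ false → pos x (w ∷ l) ≢ just 1
pos-tail≢1 {x} l e p with map-suc-just (pos x l) (trans (sym (pos-there l e)) p)
... | k , pk , refl with pos-bounded l pk
...   | _ , () , _

pos-injective : ∀ {x y} l {j} → pos x l ≡ just j → pos y l ≡ just j → x ≡ y
pos-injective {x} {y} (w ∷ l) ex ey with ≡ᵇ-view x w | ≡ᵇ-view y w
... | equal x≡w _ | equal y≡w _  = trans x≡w (sym y≡w)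
... | equal _ ew  | distinct _ e = ⊥-elim (pos-tail≢1 l e (trans ey (trans (sym ex) (pos-here l ew))))
... | distinct _ e | equal _ ew  = ⊥-elim (pos-tail≢1 l e (trans ex (trans (sym ey) (pos-here l ew))))
... | distinct _ ex′ | distinct _ ey′
  with map-suc-just (pos x l) (trans (sym (pos-there l ex′)) ex)
     | map-suc-just (pos y l) (trans (sym (pos-there l ey′)) ey)
... | _ , px , refl | _ , py , refl = pos-injective l px py

pos-surjective : ∀ l → Unique l → ∀ {j₀} → j₀ < length l → ∃ λ x → pos x l ≡ just (suc j₀)
pos-surjective (w ∷ l) (_ ∷ _) {zero} _ = w , pos-here l (≡ᵇ-refl w)
pos-surjective (w ∷ l) (w∉l ∷ u) {suc j₀} (s≤s j₀<l) with pos-surjective l u j₀<l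
... | x , px = x , trans (pos-there l (≢⇒≡ᵇ-false x≢w)) (cong (Maybe.map suc) px)
  where
  x≢w : x ≢ w
  x≢w refl = All.lookup w∉l (pos-just⇒∈ px) refl

sucLevel : ℕ × ℕ → ℕ × ℕ
sucLevel ij = suc (proj₁ ij) , proj₂ ij

addLevel : ℕ → ℕ × ℕ → ℕ × ℕ
addLevel k ij = k + proj₁ ij , proj₂ ij

find-here : ∀ {x j} l ls → pos x l ≡ just j → find x (l ∷ ls) ≡ just (1 , j)
find-here l ls e rewrite e = refl

find-there : ∀ {x} l ls → pos x l ≡ nothing → find x (l ∷ ls) ≡ Maybe.map sucLevel (find x ls)
find-there l ls e rewrite e = refl

find-there-nothing : ∀ {x} l ls → find x (l ∷ ls) ≡ nothing → pos x l ≡ nothing × find x ls ≡ nothing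
find-there-nothing {x} l ls e with pos x l
find-there-nothing l ls () | just _
... | nothing with find x ls
find-there-nothing l ls () | nothing | just _
... | nothing = refl , refl

find-view : ∀ {x} l ls {i j} → find x (l ∷ ls) ≡ just (i , j) →
  (pos x l ≡ just j × i ≡ 1) ⊎ (pos x l ≡ nothing × ∃ λ i₀ → find x ls ≡ just (i₀ , j) × i ≡ suc i₀)
find-view {x} l ls e with pos x l
find-view l ls refl | just j = inj₁ (refl , refl)
... | nothing with find x ls
find-view l ls refl | nothing | just (i₀ , j) = inj₂ (refl , i₀ , refl , refl)

find-level : ∀ {x} V {i j} → find x V ≡ just (i , j) → ∃ λ i₀ → i ≡ suc i₀ × i ≤ length V
find-level (l ∷ ls) e with find-view l ls e
... | inj₁ (_ , refl) = 0 , refl , s≤s z≤n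
... | inj₂ (_ , i₀ , f , refl) with find-level ls f
...   | _ , _ , i₀≤ = i₀ , refl , s≤s i₀≤

-- Levels are at least 1, so a symbol found in V is not at level 1 of l ∷ V.
find-below≢1 : ∀ {x} V {i₀ j} → find x V ≡ just (i₀ , j) → 1 ≢ suc i₀
find-below≢1 V f e with find-level V f
find-below≢1 V f () | _ , refl , _

find-injective : ∀ {x y} V {i j} → find x V ≡ just (i , j) → find y V ≡ just (i , j) → x ≡ y
find-injective (l ∷ ls) ex ey with find-view l ls ex | find-view l ls ey
... | inj₁ (px , _) | inj₁ (py , _) = pos-injective l px py
... | inj₁ (_ , refl) | inj₂ (_ , _ , f , e) = ⊥-elim (find-below≢1 ls f e)
... | inj₂ (_ , _ , f , e) | inj₁ (_ , refl) = ⊥-elim (find-below≢1 ls f e)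
... | inj₂ (_ , _ , fx , refl) | inj₂ (_ , _ , fy , refl) = find-injective ls fx fy

find-cons-cong : ∀ {x} l {ls ls'} → (pos x l ≡ nothing → find x ls ≡ find x ls') →
                 find x (l ∷ ls) ≡ find x (l ∷ ls')
find-cons-cong {x} l h with pos x l
... | just _  = refl
... | nothing = cong (Maybe.map sucLevel) (h refl)

find-cons-cong₂ : ∀ {x y} l l' {ls ls'} → pos x l ≡ pos y l' → find x ls ≡ find y ls' →
                  find x (l ∷ ls) ≡ find y (l' ∷ ls')
find-cons-cong₂ {x} {y} l l' e f with pos x l | pos y l'
find-cons-cong₂ l l' refl f | just _  | just _  = refl
find-cons-cong₂ l l' refl f | nothing | nothing = cong (Maybe.map sucLevel) f

find-++-inner : ∀ {x} Γ W {ij} → find x Γ ≡ just ij → find x (Γ ++ W) ≡ just ij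
find-++-inner {x} (l ∷ Γ) W e with pos x l
... | just _ = e
... | nothing with find x Γ in f
find-++-inner (l ∷ Γ) W refl | nothing | just _ rewrite find-++-inner Γ W f = refl

find-++-outer : ∀ {x} Γ W → find x Γ ≡ nothing →
                find x (Γ ++ W) ≡ Maybe.map (addLevel (length Γ)) (find x W)
find-++-outer {x} [] W _ with find x W
... | just _  = refl
... | nothing = refl
find-++-outer {x} (l ∷ Γ) W e with find-there-nothing l Γ e
... | pl , fΓ = begin
  find x (l ∷ Γ ++ W)                                               ≡⟨ find-there l (Γ ++ W) pl ⟩
  Maybe.map sucLevel (find x (Γ ++ W))                              ≡⟨ cong (Maybe.map sucLevel) (find-++-outer Γ W fΓ) ⟩
  Maybe.map sucLevel (Maybe.map (addLevel (length Γ)) (find x W))  ≡⟨ sucLevel∘addLevel (find x W) ⟩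
  Maybe.map (addLevel (suc (length Γ))) (find x W)                  ∎
  where
  open ≡.≡-Reasoning
  sucLevel∘addLevel : ∀ m → Maybe.map sucLevel (Maybe.map (addLevel (length Γ)) m) ≡ Maybe.map (addLevel (suc (length Γ))) m
  sucLevel∘addLevel (just _) = refl
  sucLevel∘addLevel nothing  = refl

emptyScopes : List (List ℕ) → List (List ℕ)
emptyScopes = map (λ _ → [])

find-emptyScopes : ∀ {x} Γ → find x (emptyScopes Γ) ≡ nothing
find-emptyScopes [] = refl
find-emptyScopes {x} (_ ∷ Γ) rewrite find-emptyScopes {x} Γ = refl

length-emptyScopes : ∀ Γ → length (emptyScopes Γ) ≡ length Γ
length-emptyScopes = length-map (λ _ → [])

find-emptied : ∀ {z} Γ W → find z Γ ≡ nothing → find z (Γ ++ W) ≡ find z (emptyScopes Γ ++ W)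
find-emptied {z} Γ W fΓ = begin
  find z (Γ ++ W)                                            ≡⟨ find-++-outer Γ W fΓ ⟩
  Maybe.map (addLevel (length Γ)) (find z W)                 ≡⟨ cong (λ k → Maybe.map (addLevel k) (find z W))
                                                                      (sym (length-emptyScopes Γ)) ⟩
  Maybe.map (addLevel (length (emptyScopes Γ))) (find z W)   ≡⟨ sym (find-++-outer (emptyScopes Γ) W (find-emptyScopes Γ)) ⟩
  find z (emptyScopes Γ ++ W)                                ∎
  where open ≡.≡-Reasoning

varAt : ℕ × ℕ → DTm
varAt ij = var (proj₁ ij) (proj₂ ij)

matAt : ℕ × ℕ → DTm
matAt ij = mat (proj₁ ij) (proj₂ ij)

map-just⁻ : ∀ {A B : Set} {f : A → B} m {b} → Maybe.map f m ≡ just b → ∃ λ a → m ≡ just a × b ≡ f a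
map-just⁻ (just a) refl = a , refl , refl

map2-just⁻ : ∀ {A B C : Set} {f : A → B → C} a b {c} → map2 f a b ≡ just c →
  ∃₂ λ x y → a ≡ just x × b ≡ just y × c ≡ f x y
map2-just⁻ (just x) (just y) refl = x , y , refl , refl , refl

just-injective : ∀ {A : Set} {a b : A} → just a ≡ just b → a ≡ b
just-injective refl = refl

fv-lam-pat : ∀ {z} θ p s → z ∈ fv p → z ∈ fv (lam θ p s)
fv-lam-pat θ p s = ∈-++⁺ˡ

fv-lam-body : ∀ {z} θ p s → z ∈ fv s → pos z θ ≡ nothing → z ∈ fv (lam θ p s)
fv-lam-body θ p s m pz = ∈-++⁺ʳ (fv p) (∈-minus⁺ (fv s) θ m (pos-nothing⇒∉ pz))

fm-lam-pat : ∀ {z} θ p s → z ∈ fm p → pos z θ ≡ nothing → z ∈ fm (lam θ p s)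
fm-lam-pat θ p s m pz = ∈-++⁺ˡ (∈-minus⁺ (fm p) θ m (pos-nothing⇒∉ pz))

fm-lam-body : ∀ {z} θ p s → z ∈ fm s → z ∈ fm (lam θ p s)
fm-lam-body θ p s = ∈-++⁺ʳ (minus (fm p) θ)

fv⊆syms : ∀ t → fv t ⊆ syms t
fv⊆syms (var x)     m = m
fv⊆syms (app t u)   m with ∈-++⁻ (fv t) m
... | inj₁ mt = ∈-++⁺ˡ (fv⊆syms t mt)
... | inj₂ mu = ∈-++⁺ʳ (syms t) (fv⊆syms u mu)
fv⊆syms (lam θ p s) m with ∈-++⁻ (fv p) m
... | inj₁ mp = ∈-++⁺ʳ θ (∈-++⁺ˡ (fv⊆syms p mp))
... | inj₂ ms = ∈-++⁺ʳ θ (∈-++⁺ʳ (syms p) (fv⊆syms s (proj₁ (∈-minus⁻ (fv s) θ ms))))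

fm⊆syms : ∀ t → fm t ⊆ syms t
fm⊆syms (mat x)     m = m
fm⊆syms (app t u)   m with ∈-++⁻ (fm t) m
... | inj₁ mt = ∈-++⁺ˡ (fm⊆syms t mt)
... | inj₂ mu = ∈-++⁺ʳ (syms t) (fm⊆syms u mu)
fm⊆syms (lam θ p s) m with ∈-++⁻ (minus (fm p) θ) m
... | inj₁ mp = ∈-++⁺ʳ θ (∈-++⁺ˡ (fm⊆syms p (proj₁ (∈-minus⁻ (fm p) θ mp))))
... | inj₂ ms = ∈-++⁺ʳ θ (∈-++⁺ʳ (syms p) (fm⊆syms s ms))

tr-ext : ∀ t {V V' M M'} → (∀ {z} → z ∈ fv t → find z V ≡ find z V') →
         (∀ {z} → z ∈ fm t → find z M ≡ find z M') → tr V M t ≡ tr V' M' t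
tr-ext (var x) hv hm = cong (Maybe.map varAt) (hv (here refl))
tr-ext (mat x) hv hm = cong (Maybe.map matAt) (hm (here refl))
tr-ext (app t u) hv hm =
  cong₂ (map2 app) (tr-ext t (λ m → hv (∈-++⁺ˡ m))        (λ m → hm (∈-++⁺ˡ m)))
                   (tr-ext u (λ m → hv (∈-++⁺ʳ (fv t) m)) (λ m → hm (∈-++⁺ʳ (fm t) m)))
tr-ext (lam θ p s) hv hm =
  cong₂ (map2 (lam (length θ)))
    (tr-ext p (λ m → hv (fv-lam-pat θ p s m))
              (λ m → find-cons-cong θ (λ pz → hm (fm-lam-pat θ p s m pz))))
    (tr-ext s (λ m → find-cons-cong θ (λ pz → hv (fv-lam-body θ p s m pz)))
              (λ m → hm (fm-lam-body θ p s m)))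

Defined : {A : Set} → Maybe A → Set
Defined {A} m = ∃ λ (a : A) → m ≡ just a

map-defined : ∀ {A B : Set} {f : A → B} {m} → Defined m → Defined (Maybe.map f m)
map-defined {f = f} (a , refl) = f a , refl

map2-defined : ∀ {A B C : Set} {f : A → B → C} {m n} → Defined m → Defined n → Defined (map2 f m n)
map2-defined {f = f} (a , refl) (b , refl) = f a b , refl

find-cons-defined : ∀ {z} l ls → (pos z l ≡ nothing → Defined (find z ls)) → Defined (find z (l ∷ ls))
find-cons-defined {z} l ls h with pos z l
... | just j  = (1 , j) , refl
... | nothing = map-defined (h refl)

tr-defined : ∀ t {V M} → (∀ {z} → z ∈ fv t → Defined (find z V)) →
             (∀ {z} → z ∈ fm t → Defined (find z M)) → Defined (tr V M t)
tr-defined (var x) hv hm = map-defined (hv (here refl))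
tr-defined (mat x) hv hm = map-defined (hm (here refl))
tr-defined (app t u) hv hm =
  map2-defined (tr-defined t (λ m → hv (∈-++⁺ˡ m))        (λ m → hm (∈-++⁺ˡ m)))
               (tr-defined u (λ m → hv (∈-++⁺ʳ (fv t) m)) (λ m → hm (∈-++⁺ʳ (fm t) m)))
tr-defined (lam θ p s) {V} {M} hv hm =
  map2-defined
    (tr-defined p (λ m → hv (fv-lam-pat θ p s m))
                  (λ m → find-cons-defined θ M (λ pz → hm (fm-lam-pat θ p s m pz))))
    (tr-defined s (λ m → find-cons-defined θ V (λ pz → hv (fv-lam-body θ p s m pz)))
                  (λ m → hm (fm-lam-body θ p s m)))

find-X : ∀ {z} l → z ∈ l → Defined (find z (map (λ k → k ∷ []) l))
find-X (k ∷ l) (here refl) = (1 , 1) , find-here {k} (k ∷ []) (map (λ k → k ∷ []) l) (pos-here {k} [] (≡ᵇ-refl k))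
find-X (k ∷ l) (there m)   = find-cons-defined (k ∷ []) (map (λ k → k ∷ []) l) (λ _ → find-X l m)

𝒯-defined : ∀ n t → Covered n t → Defined (𝒯 n t)
𝒯-defined n t cov = tr-defined t (λ m → inX (∈-++⁺ˡ m)) (λ m → inX (∈-++⁺ʳ (fv t) m))
  where
  inX : ∀ {z} → z ∈ fv t ++ fm t → Defined (find z (X n))
  inX m = find-X (upTo n) (∈-upTo⁺ (All.lookup cov m))

isData-tr : ∀ t {V M T} → tr V M t ≡ just T → isDataD T ≡ isData t
isData-tr (var x) {V} e with map-just⁻ (find x V) e
... | _ , _ , refl = refl
isData-tr (mat x) {M = M} e with map-just⁻ (find x M) e
... | _ , _ , refl = refl
isData-tr (app t u) {V} {M} e with map2-just⁻ (tr V M t) (tr V M u) e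
... | _ , _ , et , _ , refl = isData-tr t et
isData-tr (lam θ p s) {V} {M} e with map2-just⁻ (tr V (θ ∷ M) p) (tr (θ ∷ V) M s) e
... | _ , _ , _ , _ , refl = refl

isMF-tr : ∀ t {V M T} → tr V M t ≡ just T → isMFD T ≡ isMF t
isMF-tr (lam θ p s) {V} {M} e with map2-just⁻ (tr V (θ ∷ M) p) (tr (θ ∷ V) M s) e
... | _ , _ , _ , _ , refl = refl
isMF-tr (var x) {V} e with map-just⁻ (find x V) e
... | _ , _ , refl = refl
isMF-tr (mat x) {M = M} e with map-just⁻ (find x M) e
... | _ , _ , refl = refl
isMF-tr (app t u) {V} {M} e with map2-just⁻ (tr V M t) (tr V M u) e
... | _ , _ , et , _ , refl = isData-tr t et

-- Invariance under α-conversion.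

∉syms-app : ∀ {y} t u → y ∉ syms (app t u) → y ∉ syms t × y ∉ syms u
∉syms-app t u y∉ = (λ m → y∉ (∈-++⁺ˡ m)) , (λ m → y∉ (∈-++⁺ʳ (syms t) m))

∉syms-lam : ∀ {y} θ p s → y ∉ syms (lam θ p s) → y ∉ θ × y ∉ syms p × y ∉ syms s
∉syms-lam θ p s y∉ = (λ m → y∉ (∈-++⁺ˡ m)) ,
                     (λ m → y∉ (∈-++⁺ʳ θ (∈-++⁺ˡ m))) ,
                     (λ m → y∉ (∈-++⁺ʳ θ (∈-++⁺ʳ (syms p) m)))

tr-renV : ∀ s {x y V V' M} → y ∉ syms s → (∀ {z} → z ∈ fv s → z ≢ x → find z V ≡ find z V') →
          find y V ≡ find x V' → tr V M (renV x y s) ≡ tr V' M s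
tr-renV (var z) {x} _ hv fy with ≡ᵇ-view z x
... | equal refl e   rewrite e = cong (Maybe.map varAt) fy
... | distinct z≢x e rewrite e = cong (Maybe.map varAt) (hv (here refl) z≢x)
tr-renV (mat z) _ _ _ = refl
tr-renV (app t u) y∉ hv fy =
  cong₂ (map2 app) (tr-renV t (proj₁ (∉syms-app t u y∉)) (λ m → hv (∈-++⁺ˡ m)) fy)
                   (tr-renV u (proj₂ (∉syms-app t u y∉)) (λ m → hv (∈-++⁺ʳ (fv t) m)) fy)
tr-renV (lam θ p s) {x} {y} y∉ hv fy with ∉syms-lam θ p s y∉ | x ∈ᵇ θ in e
... | y∉θ , y∉p , y∉s | true =
  cong₂ (map2 (lam (length θ)))
    (tr-renV p y∉p (λ m → hv (fv-lam-pat θ p s m)) fy)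
    (tr-ext s (λ m → find-cons-cong θ (λ pz → hv (fv-lam-body θ p s m pz) (bound≢free pz))) (λ _ → refl))
  where
  bound≢free : ∀ {z} → pos z θ ≡ nothing → z ≢ x
  bound≢free pz refl = pos-nothing⇒∉ pz (∈ᵇ⇒∈ θ (≡true⇒T e))
... | y∉θ , y∉p , y∉s | false =
  cong₂ (map2 (lam (length θ)))
    (tr-renV p y∉p (λ m → hv (fv-lam-pat θ p s m)) fy)
    (tr-renV s y∉s (λ m z≢x → find-cons-cong θ (λ pz → hv (fv-lam-body θ p s m pz) z≢x))
                   (find-cons-cong₂ θ θ (trans (∉⇒pos θ y∉θ) (sym (∉⇒pos θ (∈ᵇ-false⇒∉ e)))) fy))

tr-renM : ∀ p {x y V M M'} → y ∉ syms p → (∀ {z} → z ∈ fm p → z ≢ x → find z M ≡ find z M') →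
          find y M ≡ find x M' → tr V M (renM x y p) ≡ tr V M' p
tr-renM (var z) _ _ _ = refl
tr-renM (mat z) {x} _ hm fy with ≡ᵇ-view z x
... | equal refl e   rewrite e = cong (Maybe.map matAt) fy
... | distinct z≢x e rewrite e = cong (Maybe.map matAt) (hm (here refl) z≢x)
tr-renM (app t u) y∉ hm fy =
  cong₂ (map2 app) (tr-renM t (proj₁ (∉syms-app t u y∉)) (λ m → hm (∈-++⁺ˡ m)) fy)
                   (tr-renM u (proj₂ (∉syms-app t u y∉)) (λ m → hm (∈-++⁺ʳ (fm t) m)) fy)
tr-renM (lam θ p s) {x} {y} y∉ hm fy with ∉syms-lam θ p s y∉ | x ∈ᵇ θ in e
... | y∉θ , y∉p , y∉s | true =
  cong₂ (map2 (lam (length θ)))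
    (tr-ext p (λ _ → refl) (λ m → find-cons-cong θ (λ pz → hm (fm-lam-pat θ p s m pz) (bound≢free pz))))
    (tr-renM s y∉s (λ m → hm (fm-lam-body θ p s m)) fy)
  where
  bound≢free : ∀ {z} → pos z θ ≡ nothing → z ≢ x
  bound≢free pz refl = pos-nothing⇒∉ pz (∈ᵇ⇒∈ θ (≡true⇒T e))
... | y∉θ , y∉p , y∉s | false =
  cong₂ (map2 (lam (length θ)))
    (tr-renM p y∉p (λ m z≢x → find-cons-cong θ (λ pz → hm (fm-lam-pat θ p s m pz) z≢x))
                   (find-cons-cong₂ θ θ (trans (∉⇒pos θ y∉θ) (sym (∉⇒pos θ (∈ᵇ-false⇒∉ e)))) fy))
    (tr-renM s y∉s (λ m → hm (fm-lam-body θ p s m)) fy)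

pos-swap-other : ∀ {x y z} θ → z ≢ x → z ≢ y → pos z (map (swapTo x y) θ) ≡ pos z θ
pos-swap-other [] _ _ = refl
pos-swap-other {x} {y} {z} (w ∷ θ) z≢x z≢y with ≡ᵇ-view w x
... | equal refl e rewrite e | ≢⇒≡ᵇ-false z≢x | ≢⇒≡ᵇ-false z≢y =
  cong (Maybe.map suc) (pos-swap-other θ z≢x z≢y)
... | distinct _ e rewrite e with z ≡ᵇ w
...   | true  = refl
...   | false = cong (Maybe.map suc) (pos-swap-other θ z≢x z≢y)

pos-swap-fresh : ∀ {x y} θ → y ∉ θ → pos y (map (swapTo x y) θ) ≡ pos x θ
pos-swap-fresh [] _ = refl
pos-swap-fresh {x} {y} (w ∷ θ) y∉ with ≡ᵇ-view w x
... | equal refl e rewrite e | ≡ᵇ-refl y | ≡ᵇ-refl w = refl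
... | distinct w≢x e rewrite e | ≢⇒≡ᵇ-false {y} {w} (λ { refl → y∉ (here refl) })
                               | ≢⇒≡ᵇ-false (λ x≡w → w≢x (sym x≡w)) =
  cong (Maybe.map suc) (pos-swap-fresh θ (λ m → y∉ (there m)))

tr-α-rename : ∀ θ p s x y → T (x ∈ᵇ θ) → T (not (y ∈ᵇ syms (lam θ p s))) → ∀ V M →
  tr V M (lam θ p s) ≡ tr V M (lam (map (swapTo x y) θ) (renM x y p) (renV x y s))
tr-α-rename θ p s x y x∈θ y-fresh V M
  with ∉syms-lam θ p s (∉ᵇ⇒∉ y-fresh)
... | y∉θ , y∉p , y∉s rewrite length-map (swapTo x y) θ =
  cong₂ (map2 (lam (length θ)))
    (sym (tr-renM p y∉p (λ m z≢x → other-binder z≢x (λ { refl → y∉p (fm⊆syms p m) })) (renamed-binder M)))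
    (sym (tr-renV s y∉s (λ m z≢x → other-binder z≢x (λ { refl → y∉s (fv⊆syms s m) })) (renamed-binder V)))
  where
  θ′ : List ℕ
  θ′ = map (swapTo x y) θ
  x-pos : ∃ λ j → pos x θ ≡ just j
  x-pos = ∈⇒pos (∈ᵇ⇒∈ θ x∈θ)
  renamed-binder : ∀ W → find y (θ′ ∷ W) ≡ find x (θ ∷ W)
  renamed-binder W = trans (find-here θ′ W (trans (pos-swap-fresh θ y∉θ) (proj₂ x-pos)))
                           (sym (find-here θ W (proj₂ x-pos)))
  other-binder : ∀ {z W} → z ≢ x → z ≢ y → find z (θ′ ∷ W) ≡ find z (θ ∷ W)
  other-binder z≢x z≢y = find-cons-cong₂ θ′ θ (pos-swap-other θ z≢x z≢y) refl

tr-α : ∀ {t u} → t ≈α u → ∀ V M → tr V M t ≡ tr V M u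
tr-α (α-rename {θ} {p} {s} {x} {y} x∈θ y-fresh) V M = tr-α-rename θ p s x y x∈θ y-fresh V M
tr-α α-refl           V M = refl
tr-α (α-sym r)        V M = sym (tr-α r V M)
tr-α (α-trans r r′)   V M = trans (tr-α r V M) (tr-α r′ V M)
tr-α (α-appL r)       V M = cong (λ a → map2 app a _) (tr-α r V M)
tr-α (α-appR r)       V M = cong (map2 app _) (tr-α r V M)
tr-α (α-lamP {θ} r)   V M = cong (λ a → map2 (lam (length θ)) a _) (tr-α r V (θ ∷ M))
tr-α (α-lamS {θ} r)   V M = cong (map2 (lam (length θ)) _) (tr-α r (θ ∷ V) M)

-- Renaming does not touch binder lists, so well-formedness is unchanged.
WF-renM : ∀ x y p → WF (renM x y p) ≡ WF p
WF-renM x y (var z)     = refl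
WF-renM x y (mat z)     = refl
WF-renM x y (app t u)   = cong₂ _×_ (WF-renM x y t) (WF-renM x y u)
WF-renM x y (lam θ p s) with x ∈ᵇ θ
... | true  = cong (λ A → Unique θ × WF p × A) (WF-renM x y s)
... | false = cong₂ (λ A B → Unique θ × A × B) (WF-renM x y p) (WF-renM x y s)

WF-renV : ∀ x y p → WF (renV x y p) ≡ WF p
WF-renV x y (var z)     = refl
WF-renV x y (mat z)     = refl
WF-renV x y (app t u)   = cong₂ _×_ (WF-renV x y t) (WF-renV x y u)
WF-renV x y (lam θ p s) with x ∈ᵇ θ
... | true  = cong (λ A → Unique θ × A × WF s) (WF-renV x y p)
... | false = cong₂ (λ A B → Unique θ × A × B) (WF-renV x y p) (WF-renV x y s)

swapTo-injective : ∀ {x y a b} → a ≢ y → b ≢ y → swapTo x y a ≡ swapTo x y b → a ≡ b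
swapTo-injective {x} {y} {a} {b} a≢y b≢y e with ≡ᵇ-view a x | ≡ᵇ-view b x
... | equal a≡x _ | equal b≡x _ = trans a≡x (sym b≡x)
... | equal _ ea  | distinct _ eb rewrite ea | eb = ⊥-elim (b≢y (sym e))
... | distinct _ ea | equal _ eb  rewrite ea | eb = ⊥-elim (a≢y e)
... | distinct _ ea | distinct _ eb rewrite ea | eb = e

Unique-swap : ∀ {x y} θ → y ∉ θ → Unique θ → Unique (map (swapTo x y) θ)
Unique-swap []      _  []         = []
Unique-swap (w ∷ θ) y∉ (w∉θ ∷ u) =
  AllProperties.map⁺ (All.tabulate (λ m e → All.lookup w∉θ m (swapTo-injective w≢y (λ { refl → y∉ (there m) }) e)))
  ∷ Unique-swap θ (λ m → y∉ (there m)) u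
  where
  w≢y : w ≢ _
  w≢y refl = y∉ (here refl)

WF-α : ∀ {t u} → t ≈α u → (WF t → WF u) × (WF u → WF t)
WF-α (α-rename {θ} {p} {s} {x} {y} _ y-fresh) =
  (λ { (uθ , wp , ws) → Unique-swap θ (proj₁ (∉syms-lam θ p s (∉ᵇ⇒∉ y-fresh))) uθ ,
                         ≡.subst id (sym (WF-renM x y p)) wp , ≡.subst id (sym (WF-renV x y s)) ws }) ,
  (λ { (uθ , wp , ws) → Unique.map⁻ uθ , ≡.subst id (WF-renM x y p) wp , ≡.subst id (WF-renV x y s) ws })
WF-α α-refl         = id , id
WF-α (α-sym r)      = Product.swap (WF-α r)
WF-α (α-trans r r′) = proj₁ (WF-α r′) ∘ proj₁ (WF-α r) , proj₂ (WF-α r) ∘ proj₂ (WF-α r′)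
WF-α (α-appL r) with WF-α r
... | to , from = Product.map₁ to , Product.map₁ from
WF-α (α-appR r) with WF-α r
... | to , from = Product.map₂ to , Product.map₂ from
WF-α (α-lamP r) with WF-α r
... | to , from = Product.map₂ (Product.map₁ to) , Product.map₂ (Product.map₁ from)
WF-α (α-lamS r) with WF-α r
... | to , from = Product.map₂ (Product.map₂ to) , Product.map₂ (Product.map₂ from)

bumpLevel : ℕ → ℕ × ℕ → ℕ × ℕ
bumpLevel k ij = (if k <ᵇ proj₁ ij then suc (proj₁ ij) else proj₁ ij) , proj₂ ij

bump-inner : ∀ {k} ij → proj₁ ij ≤ k → bumpLevel k ij ≡ ij
bump-inner {k} (i , j) i≤k rewrite ¬T⇒≡false (λ t → ≤⇒≯ i≤k (<ᵇ⇒< k i t)) = refl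

bump-outer : ∀ k i j → bumpLevel k (k + suc i , j) ≡ (suc k + suc i , j)
bump-outer k i j rewrite T⇒≡true (<⇒<ᵇ (m<m+n k {suc i} (s≤s z≤n))) = refl

find-insert-empty : ∀ z Γ W → find z (Γ ++ [] ∷ W) ≡ Maybe.map (bumpLevel (length Γ)) (find z (Γ ++ W))
find-insert-empty z Γ W with find z Γ in fΓ
... | just ij rewrite find-++-inner Γ W fΓ | find-++-inner Γ ([] ∷ W) fΓ =
  cong just (sym (bump-inner ij (proj₂ (proj₂ (find-level Γ fΓ)))))
... | nothing rewrite find-++-outer Γ W fΓ | find-++-outer Γ ([] ∷ W) fΓ with find z W in fW
...   | nothing = refl
...   | just (i , j) with find-level W fW
...     | i₀ , refl , _ = cong just (trans (cong (_, j) (+-suc (length Γ) (suc i₀)))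
                                          (sym (bump-outer (length Γ) i₀ j)))

upV-varAt : ∀ k ij → upV k (varAt ij) ≡ varAt (bumpLevel k ij)
upV-varAt k (i , j) with k <ᵇ i
... | true  = refl
... | false = refl

upM-matAt : ∀ k ij → upM k (matAt ij) ≡ matAt (bumpLevel k ij)
upM-matAt k (i , j) with k <ᵇ i
... | true  = refl
... | false = refl

map-map2 : ∀ {f f₁ f₂ : DTm → DTm} {g : DTm → DTm → DTm} → (∀ a b → f (g a b) ≡ g (f₁ a) (f₂ b)) →
           ∀ m n → Maybe.map f (map2 g m n) ≡ map2 g (Maybe.map f₁ m) (Maybe.map f₂ n)
map-map2 h (just a) (just b) = cong just (h a b)
map-map2 h (just _) nothing  = refl
map-map2 h nothing  _        = refl

map-map-cong : ∀ {A : Set} {f : DTm → DTm} {g : A → DTm} {h : A → A} →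
               (∀ a → f (g a) ≡ g (h a)) → ∀ m → Maybe.map f (Maybe.map g m) ≡ Maybe.map g (Maybe.map h m)
map-map-cong e (just a) = cong just (e a)
map-map-cong e nothing  = refl

map-fixed : ∀ {A : Set} {f : DTm → DTm} {g : A → DTm} → (∀ a → f (g a) ≡ g a) →
            ∀ m → Maybe.map f (Maybe.map g m) ≡ Maybe.map g m
map-fixed e (just a) = cong just (e a)
map-fixed e nothing  = refl

tr-upV : ∀ u Γ W M → Maybe.map (upV (length Γ)) (tr (Γ ++ W) M u) ≡ tr (Γ ++ [] ∷ W) M u
tr-upV (var z) Γ W M = trans (map-map-cong (upV-varAt (length Γ)) (find z (Γ ++ W)))
                             (cong (Maybe.map varAt) (sym (find-insert-empty z Γ W)))
tr-upV (mat z) Γ W M = map-fixed (λ _ → refl) (find z M)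
tr-upV (app t u) Γ W M = trans (map-map2 (λ _ _ → refl) (tr (Γ ++ W) M t) (tr (Γ ++ W) M u))
  (cong₂ (map2 app) (tr-upV t Γ W M) (tr-upV u Γ W M))
tr-upV (lam θ p s) Γ W M = trans (map-map2 (λ _ _ → refl) (tr (Γ ++ W) (θ ∷ M) p) (tr (θ ∷ Γ ++ W) M s))
  (cong₂ (map2 (lam (length θ))) (tr-upV p Γ W (θ ∷ M)) (tr-upV s (θ ∷ Γ) W M))

tr-upM : ∀ u V Δ W → Maybe.map (upM (length Δ)) (tr V (Δ ++ W) u) ≡ tr V (Δ ++ [] ∷ W) u
tr-upM (var z) V Δ W = map-fixed (λ _ → refl) (find z V)
tr-upM (mat z) V Δ W = trans (map-map-cong (upM-matAt (length Δ)) (find z (Δ ++ W)))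
                             (cong (Maybe.map matAt) (sym (find-insert-empty z Δ W)))
tr-upM (app t u) V Δ W = trans (map-map2 (λ _ _ → refl) (tr V (Δ ++ W) t) (tr V (Δ ++ W) u))
  (cong₂ (map2 app) (tr-upM t V Δ W) (tr-upM u V Δ W))
tr-upM (lam θ p s) V Δ W = trans (map-map2 (λ _ _ → refl) (tr V (θ ∷ Δ ++ W) p) (tr (θ ∷ V) (Δ ++ W) s))
  (cong₂ (map2 (lam (length θ))) (tr-upM p V (θ ∷ Δ) W) (tr-upM s (θ ∷ V) Δ W))

downV-upV : ∀ k t → downV k (upV k t) ≡ t
downV-upV k (var i j) with k <ᵇ i in e
... | true  rewrite T⇒≡true (<⇒<ᵇ (m<n⇒m<1+n (<ᵇ⇒< k i (≡true⇒T e)))) = refl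
... | false rewrite e = refl
downV-upV k (mat i j)   = refl
downV-upV k (app t u)   = cong₂ app (downV-upV k t) (downV-upV k u)
downV-upV k (lam n p s) = cong₂ (lam n) (downV-upV k p) (downV-upV (suc k) s)

isData-upV : ∀ k T → isDataD (upV k T) ≡ isDataD T
isData-upV k (var i j) with k <ᵇ i
... | true  = refl
... | false = refl
isData-upV k (mat i j)   = refl
isData-upV k (app t u)   = isData-upV k t
isData-upV k (lam n p s) = refl

isMF-upV : ∀ k T → isMFD (upV k T) ≡ isMFD T
isMF-upV k (var i j) with k <ᵇ i
... | true  = refl
... | false = refl
isMF-upV k (mat i j)   = refl
isMF-upV k (app t u)   = isData-upV k t
isMF-upV k (lam n p s) = refl

allᵇ-intro : ∀ f l → (∀ {x} → x ∈ l → T (f x)) → allᵇ f l ≡ true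
allᵇ-intro f []      _ = refl
allᵇ-intro f (w ∷ l) h rewrite T⇒≡true (h (here refl)) = allᵇ-intro f l (λ m → h (there m))

allᵇ-elim : ∀ f l → T (allᵇ f l) → ∀ {x} → x ∈ l → T (f x)
allᵇ-elim f (w ∷ l) t m with f w in e
allᵇ-elim f (w ∷ l) t (here refl) | true = ≡true⇒T e
allᵇ-elim f (w ∷ l) t (there m)   | true = allᵇ-elim f l t m

range : ℕ → List ℕ
range n = map suc (upTo n)

∈-range⁺ : ∀ {j₀ n} → j₀ < n → suc j₀ ∈ range n
∈-range⁺ j₀<n = ∈-map⁺ suc (∈-upTo⁺ j₀<n)

∈-range⁻ : ∀ {j} n → j ∈ range n → ∃ λ j₀ → j ≡ suc j₀ × j₀ < n
∈-range⁻ n m with ∈-map⁻ suc m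
... | j₀ , m₀ , refl = j₀ , refl , ∈-upTo⁻ m₀

pos∈range : ∀ {x} l {j} → pos x l ≡ just j → j ∈ range (length l)
pos∈range l e with pos-bounded l e
... | _ , refl , j₀<l = ∈-range⁺ j₀<l

-- Matching commutes with the translation.
module Matching (θ : List ℕ) (V M : List (List ℕ)) where

  BindingRel : ℕ × Term → ℕ × DTm → Set
  BindingRel (x , u) (j , R) = pos x θ ≡ just j × ∃ λ U → tr V M u ≡ just U × R ≡ upV 0 U

  SubstRel : List (ℕ × Term) → List (ℕ × DTm) → Set
  SubstRel = Pointwise BindingRel

  data MatchRel : Match Term → Match DTm → Set where
    fail : MatchRel fail fail
    wait : MatchRel wait wait
    ok   : ∀ {σ σ'} → SubstRel σ σ' → MatchRel (ok σ) (ok σ')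

  if-rel : ∀ {X Y X' Y'} {b b'} → b ≡ b' → MatchRel X X' → MatchRel Y Y' →
           MatchRel (if b then X else Y) (if b' then X' else Y')
  if-rel {b = true}  refl r _ = r
  if-rel {b = false} refl _ r = r

  fallback-rel : ∀ {p u} P U' → isMF p ≡ isMFD P → isMF u ≡ isMFD U' →
                 MatchRel (fallback p u) (fallbackD P U')
  fallback-rel {p} {u} P U' ep eu = if-rel {b = isMF p ∧ isMF u} (cong₂ _∧_ ep eu) fail wait

  ≡ᵇ-pos : ∀ {x y j k} → pos x θ ≡ just j → pos y θ ≡ just k → (x ≡ᵇ y) ≡ (j ≡ᵇ k)
  ≡ᵇ-pos {x} {y} {j} px py with ≡ᵇ-view x y
  ... | equal refl e with trans (sym px) py
  ...   | refl = trans e (sym (≡ᵇ-refl j))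
  ≡ᵇ-pos {j = j} {k} px py | distinct x≢y e =
    trans e (sym (≢⇒≡ᵇ-false {j} {k} (λ { refl → x≢y (pos-injective θ px py) })))

  ∈ᵇ-dom : ∀ {x j τ τ'} → pos x θ ≡ just j → SubstRel τ τ' → (x ∈ᵇ dom τ) ≡ (j ∈ᵇ dom τ')
  ∈ᵇ-dom px []             = refl
  ∈ᵇ-dom px ((py , _) ∷ r) = cong₂ _∨_ (≡ᵇ-pos px py) (∈ᵇ-dom px r)

  disjointᵇ-dom : ∀ {σ σ' τ τ'} → SubstRel σ σ' → SubstRel τ τ' →
                  disjointᵇ (dom σ) (dom τ) ≡ disjointᵇ (dom σ') (dom τ')
  disjointᵇ-dom {τ = τ} {τ'} rσ rτ = cong not (anyᵇ-dom rσ)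
    where
    anyᵇ-dom : ∀ {σ σ'} → SubstRel σ σ' → anyᵇ (λ x → x ∈ᵇ dom τ) (dom σ) ≡ anyᵇ (λ j → j ∈ᵇ dom τ') (dom σ')
    anyᵇ-dom []              = refl
    anyᵇ-dom ((px , _) ∷ rs) = cong₂ _∨_ (∈ᵇ-dom px rτ) (anyᵇ-dom rs)

  ⊎-rel : ∀ {a a' b b'} → MatchRel a a' → MatchRel b b' → MatchRel (a ⊎ₘ b) (a' ⊎ₘ b')
  ⊎-rel fail   _      = fail
  ⊎-rel wait   fail   = fail
  ⊎-rel wait   wait   = wait
  ⊎-rel wait   (ok _) = wait
  ⊎-rel (ok _) fail   = fail
  ⊎-rel (ok _) wait   = wait
  ⊎-rel (ok r) (ok s) = if-rel (disjointᵇ-dom r s) (ok (++⁺ r s)) fail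

  ≡ᵇ-matchable : ∀ {x y i₀ j i' j'} → find x M ≡ just (suc i₀ , j) → find y M ≡ just (i' , j') →
                 (x ≡ᵇ y) ≡ ((suc i₀ ≡ᵇ i') ∧ (j ≡ᵇ j'))
  ≡ᵇ-matchable {x} {y} {i₀} {j} {i'} {j'} fx fy with ≡ᵇ-view x y
  ... | equal refl e with trans (sym fx) fy
  ...   | refl rewrite e | ≡ᵇ-refl i₀ | ≡ᵇ-refl j = refl
  ≡ᵇ-matchable {x} {y} {i₀} {j} {i'} {j'} fx fy | distinct x≢y e with ≡ᵇ-view (suc i₀) i' | ≡ᵇ-view j j'
  ... | equal refl _ | equal refl _  = ⊥-elim (x≢y (find-injective M fx fy))
  ... | equal _ ei   | distinct _ ej rewrite e | ei | ej = refl
  ... | distinct _ ei | _            rewrite e | ei = refl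

  isMF-shifted : ∀ u {U} → tr V M u ≡ just U → isMF u ≡ isMFD (upV 0 U)
  isMF-shifted u {U} eU = sym (trans (isMF-upV 0 U) (isMF-tr u eU))

  pmatch-free-rel : ∀ x u i₀ j {U} → find x M ≡ just (suc i₀ , j) → (x ∈ᵇ θ) ≡ false → tr V M u ≡ just U →
                    MatchRel (pmatch θ (mat x) u) (dmatch (mat (suc (suc i₀)) j) (upV 0 U))
  pmatch-free-rel x (mat y) i₀ j fx e eU rewrite e with map-just⁻ (find y M) eU
  ... | _ , fy , refl = if-rel (≡ᵇ-matchable fx fy) (ok []) fail
  pmatch-free-rel x (var y) i₀ j fx e eU rewrite e with map-just⁻ (find y V) eU
  ... | _ , fy , refl with find-level V fy
  ...   | _ , refl , _ = wait
  pmatch-free-rel x (app t u) i₀ j fx e eU rewrite e with map2-just⁻ (tr V M t) (tr V M u) eU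
  ... | A , B , _ , _ , refl =
    fallback-rel {mat x} {app t u} (mat (suc (suc i₀)) j) (upV 0 (app A B)) refl (isMF-shifted (app t u) eU)
  pmatch-free-rel x (lam θ' p s) i₀ j fx e eU rewrite e with map2-just⁻ (tr V (θ' ∷ M) p) (tr (θ' ∷ V) M s) eU
  ... | A , B , _ , _ , refl =
    fallback-rel {mat x} {lam θ' p s} (mat (suc (suc i₀)) j) (upV 0 (lam (length θ') A B))
                 refl (isMF-shifted (lam θ' p s) eU)

  pmatch-rel : ∀ p u {P U} → tr V (θ ∷ M) p ≡ just P → tr V M u ≡ just U →
               MatchRel (pmatch θ p u) (dmatch P (upV 0 U))
  pmatch-mat-rel : ∀ x u b → (x ∈ᵇ θ) ≡ b → ∀ {P U} → tr V (θ ∷ M) (mat x) ≡ just P → tr V M u ≡ just U →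
                   MatchRel (pmatch θ (mat x) u) (dmatch P (upV 0 U))
  pmatch-app-rel : ∀ p q u {P₁ P₂ U} → tr V (θ ∷ M) p ≡ just P₁ → tr V (θ ∷ M) q ≡ just P₂ →
                   tr V M u ≡ just U → MatchRel (pmatch θ (app p q) u) (dmatch (app P₁ P₂) (upV 0 U))

  pmatch-rel (var x) u {U = U} eP eU with map-just⁻ (find x V) eP
  ... | (i , j) , _ , refl = fallback-rel {var x} {u} (var i j) (upV 0 U) refl (isMF-shifted u eU)
  pmatch-rel (mat x) u eP eU = pmatch-mat-rel x u (x ∈ᵇ θ) refl eP eU
  pmatch-rel (app p q) u eP eU with map2-just⁻ (tr V (θ ∷ M) p) (tr V (θ ∷ M) q) eP
  ... | _ , _ , ep , eq , refl = pmatch-app-rel p q u ep eq eU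
  pmatch-rel (lam θ' p s) u {U = U} eP eU with map2-just⁻ (tr V (θ' ∷ θ ∷ M) p) (tr (θ' ∷ V) (θ ∷ M) s) eP
  ... | A , B , _ , _ , refl = fallback-rel {lam θ' p s} {u} (lam (length θ') A B) (upV 0 U) refl (isMF-shifted u eU)

  -- x ∈ θ is translated to m_{1,pos x θ}, which binds v_{1,pos x θ}.
  pmatch-mat-rel x u true e {U = U} eP eU with ∈⇒pos (∈ᵇ⇒∈ θ (≡true⇒T e))
  ... | j , pj with just-injective (trans (sym (cong (Maybe.map matAt) (find-here θ M pj))) eP)
  ...   | refl rewrite e = ok ((pj , U , eU , refl) ∷ [])
  -- x ∉ θ is translated to its outer index shifted past θ.
  pmatch-mat-rel x u false e eP eU
    with map-just⁻ (Maybe.map sucLevel (find x M))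
                   (trans (sym (cong (Maybe.map matAt) (find-there θ M (∉⇒pos θ (∈ᵇ-false⇒∉ e))))) eP)
  ... | _ , e′ , refl with map-just⁻ (find x M) e′
  ...   | (i , j) , fx , refl with find-level M fx
  ...     | i₀ , refl , _ = pmatch-free-rel x u i₀ j fx e eU

  pmatch-app-rel p q (app t u) {P₁} {P₂} ep eq eU with map2-just⁻ (tr V M t) (tr V M u) eU
  ... | T₁ , U₁ , et , eu , refl =
    if-rel {b = isMF (app p q) ∧ isMF (app t u)} (cong₂ _∧_ pattern-data (sym (trans (isData-upV 0 T₁) (isData-tr t et))))
      (⊎-rel (pmatch-rel p t ep et) (pmatch-rel q u eq eu))
      (fallback-rel {app p q} {app t u} (app P₁ P₂) (upV 0 (app T₁ U₁))
                    pattern-data (sym (trans (isData-upV 0 T₁) (isData-tr t et))))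
    where
    pattern-data : isData p ≡ isDataD P₁
    pattern-data = sym (isData-tr p ep)
  pmatch-app-rel p q (var y) {P₁} {P₂} ep eq eU with map-just⁻ (find y V) eU
  ... | (_ , j') , fy , refl with find-level V fy
  ...   | k , refl , _ = fallback-rel {app p q} {var y} (app P₁ P₂) (var (suc (suc k)) j') (sym (isData-tr p ep)) refl
  pmatch-app-rel p q (mat y) {P₁} {P₂} ep eq eU with map-just⁻ (find y M) eU
  ... | (i' , j') , fy , refl = fallback-rel {app p q} {mat y} (app P₁ P₂) (mat i' j') (sym (isData-tr p ep)) refl
  pmatch-app-rel p q (lam θ' t u) {P₁} {P₂} ep eq eU with map2-just⁻ (tr V (θ' ∷ M) t) (tr (θ' ∷ V) M u) eU
  ... | A , B , _ , _ , refl =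
    fallback-rel {app p q} {lam θ' t u} (app P₁ P₂) (upV 0 (lam (length θ') A B)) (sym (isData-tr p ep)) refl

  keys∈θ : ∀ {σ σ' x} → SubstRel σ σ' → x ∈ dom σ → ∃ λ j → pos x θ ≡ just j
  keys∈θ ((px , _) ∷ _) (here refl) = _ , px
  keys∈θ (_ ∷ r)        (there m)   = keys∈θ r m

  keys∈range : ∀ {σ σ' j} → SubstRel σ σ' → j ∈ dom σ' → j ∈ range (length θ)
  keys∈range ((px , _) ∷ _) (here refl) = pos∈range θ px
  keys∈range (_ ∷ r)        (there m)   = keys∈range r m

  -- Hence, when θ has no repetitions, dom σ is θ exactly when dom σ' is
  -- {1,…,|θ|}: pos is a bijection between them.
  sameSet-rel : ∀ {σ σ'} → Unique θ → SubstRel σ σ' →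
                sameSet (dom σ) θ ≡ sameSet (dom σ') (range (length θ))
  sameSet-rel {σ} {σ'} uθ r = cong₂ _∧_ (trans keys-in-θ (sym keys-in-range)) θ-covered
    where
    keys-in-θ : allᵇ (λ x → x ∈ᵇ θ) (dom σ) ≡ true
    keys-in-θ = allᵇ-intro _ (dom σ) (λ m → ∈⇒∈ᵇ (pos-just⇒∈ {l = θ} (proj₂ (keys∈θ r m))))
    keys-in-range : allᵇ (λ j → j ∈ᵇ range (length θ)) (dom σ') ≡ true
    keys-in-range = allᵇ-intro _ (dom σ') (λ m → ∈⇒∈ᵇ (keys∈range r m))
    θ-covered : allᵇ (λ x → x ∈ᵇ dom σ) θ ≡ allᵇ (λ j → j ∈ᵇ dom σ') (range (length θ))
    θ-covered = T-ext
      (λ t → ≡true⇒T (allᵇ-intro _ (range (length θ)) λ m → index-covered t m))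
      (λ t → ≡true⇒T (allᵇ-intro _ θ λ m → symbol-covered t m))
      where
      index-covered : T (allᵇ (λ x → x ∈ᵇ dom σ) θ) → ∀ {j} → j ∈ range (length θ) → T (j ∈ᵇ dom σ')
      index-covered t m with ∈-range⁻ (length θ) m
      ... | _ , refl , j₀<θ with pos-surjective θ uθ j₀<θ
      ...   | x , px = ≡.subst T (∈ᵇ-dom px r) (allᵇ-elim _ θ t (pos-just⇒∈ px))
      symbol-covered : T (allᵇ (λ j → j ∈ᵇ dom σ') (range (length θ))) → ∀ {x} → x ∈ θ → T (x ∈ᵇ dom σ)
      symbol-covered t m with ∈⇒pos m
      ... | j , px = ≡.subst T (sym (∈ᵇ-dom px r)) (allᵇ-elim _ (range (length θ)) t (pos∈range θ px))

  match-rel : ∀ p u {P U} → Unique θ → tr V (θ ∷ M) p ≡ just P → tr V M u ≡ just U →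
              MatchRel (matchPPC θ p u) (matchDB (length θ) P (upV 0 U))
  match-rel p u {P} {U} uθ eP eU with pmatch θ p u | dmatch P (upV 0 U) | pmatch-rel p u eP eU
  ... | .fail  | .fail   | fail = fail
  ... | .wait  | .wait   | wait = wait
  ... | .ok σ  | .ok σ'  | ok r = if-rel (sameSet-rel uθ r) (ok r) fail

  ok-rel : ∀ {a b σ} → MatchRel a b → a ≡ ok σ → ∃ λ σ' → b ≡ ok σ' × SubstRel σ σ'
  ok-rel (ok r) refl = _ , refl , r

  fail-rel : ∀ {a b} → MatchRel a b → a ≡ fail → b ≡ fail
  fail-rel fail refl = refl

  lookup-rel : ∀ {σ σ' z j} → SubstRel σ σ' → pos z θ ≡ just j →
    (lookup σ z ≡ nothing × lookup σ' j ≡ nothing) ⊎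
    (∃₂ λ u U → lookup σ z ≡ just u × tr V M u ≡ just U × lookup σ' j ≡ just (upV 0 U))
  lookup-rel [] pz = inj₁ (refl , refl)
  lookup-rel {(x , u) ∷ σ} {z = z} ((px , U , eU , refl) ∷ r) pz with z ≡ᵇ x in e
  ... | true  rewrite trans (sym (≡ᵇ-pos pz px)) e = inj₂ (u , U , refl , eU , refl)
  ... | false rewrite trans (sym (≡ᵇ-pos pz px)) e = lookup-rel r pz

matchPPC-dom : ∀ θ p u {σ} → matchPPC θ p u ≡ ok σ → T (sameSet (dom σ) θ)
matchPPC-dom θ p u e with pmatch θ p u
... | ok σ₀ with sameSet (dom σ₀) θ in e′
matchPPC-dom θ p u refl | ok σ₀ | true = ≡true⇒T e′

lookup-mapRange : ∀ (f : DTm → DTm) σ j → lookup (mapRange f σ) j ≡ Maybe.map f (lookup σ j)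
lookup-mapRange f []            j = refl
lookup-mapRange f ((k , _) ∷ σ) j with j ≡ᵇ k
... | true  = refl
... | false = lookup-mapRange f σ j

lookup⇒∈dom : ∀ {A : Set} (σ : List (ℕ × A)) {z u} → lookup σ z ≡ just u → z ∈ dom σ
lookup⇒∈dom ((x , _) ∷ σ) {z} e with ≡ᵇ-view z x
... | equal z≡x _   = here z≡x
... | distinct _ ez rewrite ez = there (lookup⇒∈dom σ e)

∈dom⇒lookup : ∀ {A : Set} (σ : List (ℕ × A)) {z} → z ∈ dom σ → ∃ λ u → lookup σ z ≡ just u
∈dom⇒lookup ((x , a) ∷ σ) {z} m with ≡ᵇ-view z x | m
... | equal _ ez    | _        rewrite ez = a , refl
... | distinct z≢x _ | here z≡x = ⊥-elim (z≢x z≡x)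
... | distinct _ ez | there m′ rewrite ez = ∈dom⇒lookup σ m′

lookup⊆rangeSyms : ∀ (σ : List (ℕ × Term)) {z u} → lookup σ z ≡ just u → (fv u ++ fm u) ⊆ rangeSyms σ
lookup⊆rangeSyms ((x , a) ∷ σ) {z} e m with z ≡ᵇ x
lookup⊆rangeSyms ((x , a) ∷ σ) refl m | true  = ∈-++⁺ˡ m
... | false = ∈-++⁺ʳ (fv a ++ fm a) (lookup⊆rangeSyms σ e m)

dropDom-∈ : ∀ σ β {z} → z ∈ β → lookup (dropDom σ β) z ≡ nothing
dropDom-∈ []            β _ = refl
dropDom-∈ ((x , u) ∷ σ) β {z} m with x ∈ᵇ β in e
... | true = dropDom-∈ σ β m
... | false with ≡ᵇ-view z x
...   | equal refl _ = ⊥-elim (≡false⇒¬T e (∈⇒∈ᵇ m))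
...   | distinct _ ez rewrite ez = dropDom-∈ σ β m

dropDom-∉ : ∀ σ β {z} → z ∉ β → lookup (dropDom σ β) z ≡ lookup σ z
dropDom-∉ []            β _ = refl
dropDom-∉ ((x , u) ∷ σ) β {z} z∉β with x ∈ᵇ β in e
... | true rewrite ≢⇒≡ᵇ-false {z} {x} (λ { refl → z∉β (∈ᵇ⇒∈ β (≡true⇒T e)) }) = dropDom-∉ σ β z∉β
... | false with z ≡ᵇ x
...   | true  = refl
...   | false = dropDom-∉ σ β z∉β

disjoint⇒∉ : ∀ {β L z} → T (disjointᵇ β L) → z ∈ L → z ∉ β
disjoint⇒∉ {β} {L} {z} d zL zβ = ≡false⇒¬T (Equivalence.to T-not-≡ d) (some∈L zβ)
  where
  some∈L : ∀ {β} → z ∈ β → T (anyᵇ (λ x → x ∈ᵇ L) β)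
  some∈L {w ∷ β} (here refl) with w ∈ᵇ L in e
  ... | true  = tt
  ... | false = ⊥-elim (≡false⇒¬T e (∈⇒∈ᵇ zL))
  some∈L {w ∷ β} (there m) with w ∈ᵇ L
  ... | true  = tt
  ... | false = some∈L m

-- Substitution commutes with the translation.  To get through abstractions inside s the
-- statement is generalised: Γ and Δ are the variable and matchable scopes
-- crossed so far, all fresh for the symbols L of the range of σ (nothing is
-- captured), and σ, σ' are the substitutions as pushed under those binders.
module Substitution (θ : List ℕ) (V M : List (List ℕ)) (L : List ℕ) where

  Fresh : List ℕ → Set
  Fresh β = T (disjointᵇ β L)

  find-fresh : ∀ {z} Γ → All Fresh Γ → z ∈ L → find z Γ ≡ nothing
  find-fresh []      []       _  = refl
  find-fresh {z} (β ∷ Γ) (d ∷ ds) zL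
    rewrite find-there β Γ (∉⇒pos β (disjoint⇒∉ d zL)) | find-fresh Γ ds zL = refl

  -- The invariant between σ and σ' after crossing Γ and Δ: a symbol of θ not
  -- rebound in Γ is sent by σ to some u and by σ' (at its position) to the
  -- translation of u under the crossed scopes, emptied; σ binds nothing else.
  record Agree (Γ Δ : List (List ℕ)) (σ : List (ℕ × Term)) (σ' : List (ℕ × DTm)) : Set where
    field
      substituted : ∀ {z j} → find z Γ ≡ nothing → pos z θ ≡ just j →
        ∃₂ λ u R → lookup σ z ≡ just u × lookup σ' j ≡ just R ×
                   tr (emptyScopes Γ ++ [] ∷ V) (emptyScopes Δ ++ M) u ≡ just R × (fv u ++ fm u) ⊆ L
      untouched : ∀ {z} → Defined (find z Γ) ⊎ pos z θ ≡ nothing → lookup σ z ≡ nothing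
  open Agree

  agree-pat : ∀ {Γ Δ σ σ'} β → Agree Γ Δ σ σ' → Agree Γ (β ∷ Δ) σ (mapRange (upM 0) σ')
  substituted (agree-pat {Γ} {Δ} {σ} {σ'} β a) fΓ pz with substituted a fΓ pz
  ... | u , R , lu , lR , eR , u⊆L =
    u , upM 0 R , lu , trans (lookup-mapRange (upM 0) σ' _) (cong (Maybe.map (upM 0)) lR) ,
    trans (sym (tr-upM u (emptyScopes Γ ++ [] ∷ V) [] (emptyScopes Δ ++ M))) (cong (Maybe.map (upM 0)) eR) , u⊆L
  untouched (agree-pat β a) = untouched a

  -- Crossing the binders of a body: they shadow θ, so σ drops them.
  agree-body : ∀ {Γ Δ σ σ'} β → Agree Γ Δ σ σ' → Agree (β ∷ Γ) Δ (dropDom σ β) (mapRange (upV 0) σ')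
  substituted (agree-body {Γ} {Δ} {σ} {σ'} β a) {z} fβΓ pz with find-there-nothing β Γ fβΓ
  ... | pβ , fΓ with substituted a fΓ pz
  ...   | u , R , lu , lR , eR , u⊆L =
    u , upV 0 R , trans (dropDom-∉ σ β (pos-nothing⇒∉ pβ)) lu ,
    trans (lookup-mapRange (upV 0) σ' _) (cong (Maybe.map (upV 0)) lR) ,
    trans (sym (tr-upV u [] (emptyScopes Γ ++ [] ∷ V) (emptyScopes Δ ++ M))) (cong (Maybe.map (upV 0)) eR) ,
    u⊆L
  untouched (agree-body {Γ} {σ = σ} β a) {z} c with pos z β in pβ
  ... | just _  = dropDom-∈ σ β (pos-just⇒∈ pβ)
  ... | nothing = trans (dropDom-∉ σ β (pos-nothing⇒∉ pβ)) (untouched a (outside-β c))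
    where
    outside-β : Defined (Maybe.map sucLevel (find z Γ)) ⊎ pos z θ ≡ nothing →
                Defined (find z Γ) ⊎ pos z θ ≡ nothing
    outside-β (inj₁ (_ , e)) = inj₁ (Product.map₂ proj₁ (map-just⁻ (find z Γ) e))
    outside-β (inj₂ pz)      = inj₂ pz

  -- A substituted term, translated under the emptied scopes, translates the
  -- same way under the real ones, up to ↓ᵛ: its symbols avoid Γ and Δ.
  substituted-tr : ∀ Γ Δ u {R} → All Fresh Γ → All Fresh Δ → (fv u ++ fm u) ⊆ L →
    tr (emptyScopes Γ ++ [] ∷ V) (emptyScopes Δ ++ M) u ≡ just R →
    tr (Γ ++ V) (Δ ++ M) u ≡ just (downV (length Γ) R)
  substituted-tr Γ Δ u {R} fΓ fΔ u⊆L eR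
    with map-just⁻ (tr (emptyScopes Γ ++ V) (emptyScopes Δ ++ M) u)
                   (trans (tr-upV u (emptyScopes Γ) V (emptyScopes Δ ++ M)) eR)
  ... | R₀ , e₀ , refl = begin
    tr (Γ ++ V) (Δ ++ M) u
      ≡⟨ tr-ext u (λ m → find-emptied Γ V (find-fresh Γ fΓ (u⊆L (∈-++⁺ˡ m))))
                  (λ m → find-emptied Δ M (find-fresh Δ fΔ (u⊆L (∈-++⁺ʳ (fv u) m)))) ⟩
    tr (emptyScopes Γ ++ V) (emptyScopes Δ ++ M) u
      ≡⟨ e₀ ⟩
    just R₀
      ≡⟨ cong just (sym (downV-upV (length Γ) R₀)) ⟩
    just (downV (length Γ) (upV (length Γ) R₀))
      ≡⟨ cong (λ k → just (downV (length Γ) (upV k R₀))) (sym (length-emptyScopes Γ)) ⟩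
    just (downV (length Γ) (upV (length (emptyScopes Γ)) R₀))
      ∎
    where open ≡.≡-Reasoning

  level-inner : ∀ {i k} → i ≤ k → (i ≡ᵇ suc k) ≡ false × (k <ᵇ i) ≡ false
  level-inner {i} {k} i≤k = ≢⇒≡ᵇ-false {i} {suc k} (λ { refl → 1+n≰n i≤k }) ,
                            ¬T⇒≡false (λ t → ≤⇒≯ i≤k (<ᵇ⇒< k i t))

  level-θ : ∀ k → ((k + 1) ≡ᵇ suc k) ≡ true
  level-θ k rewrite +-comm k 1 = ≡ᵇ-refl k

  level-outer : ∀ k i → ((k + suc (suc i)) ≡ᵇ suc k) ≡ false × (k <ᵇ (k + suc (suc i))) ≡ true
  level-outer k i = ≢⇒≡ᵇ-false {k + suc (suc i)} {suc k} (λ e → m+1+n≢m k (suc-injective (trans (sym (+-suc k (suc i))) e))) ,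
                    T⇒≡true (<⇒<ᵇ (m<m+n k {suc (suc i)} (s≤s z≤n)))

  find-in-θ : ∀ {z j} Γ → find z Γ ≡ nothing → pos z θ ≡ just j → find z (Γ ++ θ ∷ V) ≡ just (length Γ + 1 , j)
  find-in-θ Γ fz pz = trans (find-++-outer Γ (θ ∷ V) fz) (cong (Maybe.map (addLevel (length Γ))) (find-here θ V pz))

  find-beyond-θ : ∀ {z} Γ → find z Γ ≡ nothing → pos z θ ≡ nothing →
    find z (Γ ++ θ ∷ V) ≡ Maybe.map (addLevel (length Γ)) (Maybe.map sucLevel (find z V))
  find-beyond-θ Γ fz pz = trans (find-++-outer Γ (θ ∷ V) fz) (cong (Maybe.map (addLevel (length Γ))) (find-there θ V pz))

  -- A variable occurrence is either bound in Γ (left alone), a symbol of θ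
  -- (substituted), or outer (its level drops by one as θ disappears).
  subst-var : ∀ z Γ Δ σ σ' {S} → All Fresh Γ → All Fresh Δ → Agree Γ Δ σ σ' →
    tr (Γ ++ θ ∷ V) (Δ ++ M) (var z) ≡ just S →
    tr (Γ ++ V) (Δ ++ M) (subst σ (var z)) ≡ just (downV (length Γ) (dsubst (suc (length Γ)) σ' S))
  subst-var z Γ Δ σ σ' fΓ fΔ a eS with find z Γ in fz
  ... | just (i , j) with just-injective (trans (sym eS) (cong (Maybe.map varAt) (find-++-inner Γ (θ ∷ V) fz)))
  ...   | refl with level-inner {i} {length Γ} (proj₂ (proj₂ (find-level Γ fz)))
  ...     | no-subst , no-shift
            rewrite untouched a (inj₁ (_ , fz)) | find-++-inner Γ V fz | no-subst | no-shift = refl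
  subst-var z Γ Δ σ σ' fΓ fΔ a eS | nothing with pos z θ in pz
  ... | just j with substituted a fz pz
  ...   | u , R , lu , lR , eR , u⊆L
          with just-injective (trans (sym eS) (cong (Maybe.map varAt) (find-in-θ Γ fz pz)))
  ...     | refl rewrite lu | level-θ (length Γ) | lR = substituted-tr Γ Δ u fΓ fΔ u⊆L eR
  subst-var z Γ Δ σ σ' fΓ fΔ a eS | nothing | nothing with map-just⁻ (find z (Γ ++ θ ∷ V)) eS
  ... | _ , eij , refl
        with map-just⁻ (Maybe.map sucLevel (find z V)) (trans (sym (find-beyond-θ Γ fz pz)) eij)
  ...   | _ , e′ , refl with map-just⁻ (find z V) e′
  ...     | (i , j) , fV , refl with find-level V fV
  ...       | i₀ , refl , _ with level-outer (length Γ) i₀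
  ...         | no-subst , shift
                rewrite untouched a (inj₂ pz) | find-++-outer Γ V fz | fV | no-subst | shift =
                  cong (λ l → just (var l j)) (sym (cong (_∸ 1) (+-suc (length Γ) (suc i₀))))

  subst-tr : ∀ s Γ Δ σ σ' {S} → Avoids L s → All Fresh Γ → All Fresh Δ → Agree Γ Δ σ σ' →
    tr (Γ ++ θ ∷ V) (Δ ++ M) s ≡ just S →
    tr (Γ ++ V) (Δ ++ M) (subst σ s) ≡ just (downV (length Γ) (dsubst (suc (length Γ)) σ' S))
  subst-tr (var z) Γ Δ σ σ' _ fΓ fΔ a eS = subst-var z Γ Δ σ σ' fΓ fΔ a eS
  subst-tr (mat z) Γ Δ σ σ' _ fΓ fΔ a eS with map-just⁻ (find z (Δ ++ M)) eS
  ... | _ , fz , refl rewrite fz = refl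
  subst-tr (app t u) Γ Δ σ σ' (at , au) fΓ fΔ a eS
    with map2-just⁻ (tr (Γ ++ θ ∷ V) (Δ ++ M) t) (tr (Γ ++ θ ∷ V) (Δ ++ M) u) eS
  ... | _ , _ , et , eu , refl
    rewrite subst-tr t Γ Δ σ σ' at fΓ fΔ a et | subst-tr u Γ Δ σ σ' au fΓ fΔ a eu = refl
  subst-tr (lam β p s) Γ Δ σ σ' (fβ , ap , as) fΓ fΔ a eS
    with map2-just⁻ (tr (Γ ++ θ ∷ V) (β ∷ Δ ++ M) p) (tr (β ∷ Γ ++ θ ∷ V) (Δ ++ M) s) eS
  ... | _ , _ , ep , es , refl
    rewrite subst-tr p Γ (β ∷ Δ) σ (mapRange (upM 0) σ') ap fΓ (fβ ∷ fΔ) (agree-pat β a) ep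
          | subst-tr s (β ∷ Γ) Δ (dropDom σ β) (mapRange (upV 0) σ') as (fβ ∷ fΓ) fΔ (agree-body β a) es = refl

agree-init : ∀ θ V M σ σ' → Matching.SubstRel θ V M σ σ' → T (sameSet (dom σ) θ) →
             Substitution.Agree θ V M (rangeSyms σ) [] [] σ σ'
agree-init θ V M σ σ' r dom≈θ = record { substituted = substituted ; untouched = untouched }
  where
  open Matching θ V M using (lookup-rel)
  dom⊆θ : T (allᵇ (λ x → x ∈ᵇ θ) (dom σ))
  dom⊆θ = proj₁ (Equivalence.to T-∧ dom≈θ)
  θ⊆dom : T (allᵇ (λ x → x ∈ᵇ dom σ) θ)
  θ⊆dom = proj₂ (Equivalence.to T-∧ dom≈θ)

  substituted : ∀ {z j} → find z [] ≡ nothing → pos z θ ≡ just j →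
    ∃₂ λ u R → lookup σ z ≡ just u × lookup σ' j ≡ just R × tr ([] ∷ V) M u ≡ just R × (fv u ++ fm u) ⊆ rangeSyms σ
  substituted {z} _ pz with lookup-rel r pz
  ... | inj₁ (lσ , _) with ∈dom⇒lookup σ (∈ᵇ⇒∈ (dom σ) (allᵇ-elim _ θ θ⊆dom (pos-just⇒∈ pz)))
  ...   | _ , lσ′ with trans (sym lσ) lσ′
  ...     | ()
  substituted _ pz | inj₂ (u , U , lu , eU , lR) =
    u , upV 0 U , lu , lR , trans (sym (tr-upV u [] V M)) (cong (Maybe.map (upV 0)) eU) , lookup⊆rangeSyms σ lu

  untouched : ∀ {z} → Defined (find z []) ⊎ pos z θ ≡ nothing → lookup σ z ≡ nothing
  untouched (inj₁ (_ , ()))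
  untouched {z} (inj₂ pz) with lookup σ z in e
  ... | nothing = refl
  ... | just _  = ⊥-elim (pos-nothing⇒∉ pz (∈ᵇ⇒∈ θ (allᵇ-elim _ (dom σ) dom⊆θ (lookup⇒∈dom σ e))))

tr-redex : ∀ θ p s u V M {a} → tr V M (app (lam θ p s) u) ≡ just a →
  ∃₂ λ P S → ∃ λ U → tr V (θ ∷ M) p ≡ just P × tr (θ ∷ V) M s ≡ just S × tr V M u ≡ just U ×
                     a ≡ app (lam (length θ) P S) U
tr-redex θ p s u V M e with map2-just⁻ (map2 (lam (length θ)) (tr V (θ ∷ M) p) (tr (θ ∷ V) M s)) (tr V M u) e
... | _ , U , eF , eU , refl with map2-just⁻ (tr V (θ ∷ M) p) (tr (θ ∷ V) M s) eF
...   | P , S , eP , eS , refl = P , S , U , eP , eS , eU , refl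

simulate : ∀ {t t'} → t ⟶ t' → WF t → ∀ V M {a} → tr V M t ≡ just a → ∃ λ b → tr V M t' ≡ just b × a ⟶ᵈ b
simulate (β-ok {θ} {p} {s} {u} {σ} matched avoids) ((uθ , _) , _) V M e with tr-redex θ p s u V M e
... | P , S , U , eP , eS , eU , refl
  with Matching.ok-rel θ V M (Matching.match-rel θ V M p u uθ eP eU) matched
...   | σ' , matchedᵈ , r =
  downV 0 (dsubst 1 σ' S) ,
  Substitution.subst-tr θ V M (rangeSyms σ) s [] [] σ σ' avoids [] []
    (agree-init θ V M σ σ' r (matchPPC-dom θ p u matched)) eS ,
  β-ok matchedᵈ
simulate (β-fail {θ} {p} {s} {u} failed) ((uθ , _) , _) V M e with tr-redex θ p s u V M e
... | P , S , U , eP , eS , eU , refl =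
  downV 0 failDB , refl , β-fail (Matching.fail-rel θ V M (Matching.match-rel θ V M p u uθ eP eU) failed)
simulate (⟶appL {t} {t'} {u} step) (wt , _) V M e with map2-just⁻ (tr V M t) (tr V M u) e
... | _ , B , et , eu , refl with simulate step wt V M et
...   | b , eb , stepᵈ rewrite eb | eu = app b B , refl , ⟶appL stepᵈ
simulate (⟶appR {t} {u} {u'} step) (_ , wu) V M e with map2-just⁻ (tr V M t) (tr V M u) e
... | A , _ , et , eu , refl with simulate step wu V M eu
...   | b , eb , stepᵈ rewrite eb | et = app A b , refl , ⟶appR stepᵈ
simulate (⟶lamP {θ} {p} {p'} {s} step) (_ , wp , _) V M e with map2-just⁻ (tr V (θ ∷ M) p) (tr (θ ∷ V) M s) e
... | _ , B , ep , es , refl with simulate step wp V (θ ∷ M) ep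
...   | b , eb , stepᵈ rewrite eb | es = lam (length θ) b B , refl , ⟶lamP stepᵈ
simulate (⟶lamS {θ} {p} {s} {s'} step) (_ , _ , ws) V M e with map2-just⁻ (tr V (θ ∷ M) p) (tr (θ ∷ V) M s) e
... | A , _ , ep , es , refl with simulate step ws (θ ∷ V) M es
...   | b , eb , stepᵈ rewrite eb | ep = lam (length θ) A b , refl , ⟶lamS stepᵈ

-- Theorem 5.3.  A PPC step t →PPC t' goes through α-equivalent raw
-- representatives t₁ ⟶ t₂; their translations equal those of t and t', and
-- the raw step is simulated, with the trivial permutation on both sides.
theorem5p3 : (n : ℕ) (t t' : Term) → WF t → Covered n t → t →PPC t' →
    ∃₂ λ a b → 𝒯 n t ≡ just a × 𝒯 n t' ≡ just b × a →dB b
theorem5p3 n t t' wf cov (t₁ , t₂ , t≈t₁ , step , t₂≈t')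
  with 𝒯-defined n t cov
... | a , 𝒯t≡a
  with simulate step (proj₁ (WF-α t≈t₁) wf) (X n) (X n) (trans (sym (tr-α t≈t₁ (X n) (X n))) 𝒯t≡a)
...   | b , 𝒯t₂≡b , stepᵈ =
  a , b , 𝒯t≡a , trans (sym (tr-α t₂≈t' (X n) (X n))) 𝒯t₂≡b , (a , b , ≈-refl , stepᵈ , ≈-refl)
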